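{- For $u\in D_p$, $v\in D_q$ and $\iota\in S^{(p,q)}$ the set $w_\iota$ is a $(p+q)$-tubing of the edgeless graph on $p+q$ nodes, and the product $F_u\cdot F_v=\sum_{\iota\in S^{(p,q)}}F_{w_\iota}$ (extended bilinearly, with $1$ a two-sided unit) makes $\Delta Sym$ an associative graded algebra.
   Context: Let $E_n$ denote the edgeless graph on nodes $1,\dots,n$. Its tubes are the singletons $\{i\}$, together with the universal tube $[n]$; a tubing of $E_n$ is a set of singletons together with $[n]$ that does not contain all $n$ singletons (for $n\ge2$), and an $n$-tubing is a tubing with exactly $n$ tubes, i.e. $[n]$ together with all singletons except one. $D_n$ is the set of $n$-tubings of $E_n$. $\Delta Sym$ is the graded $\mathbb{Q}$-vector space with degree-$n$ basis $\{F_u:u\in D_n\}$ and $1$ in degree 0. $S^{(p,q)}$ is the set of permutations $\iota$ of $[p+q]$ with $\iota(1)<\dots<\iota(p)$ and $\iota(p+1)<\dots<\iota(p+q)$; $\hat\iota(i)=\iota(p+i)$. For $u\in D_p$, $v\in D_q$, $\iota\in S^{(p,q)}$: $w_\iota$ consists of the singletons $\{\iota(i)\}$ for $i\in[p]$, the tubes $\hat\iota(t)$ for non-universal tubes $t\in v$, and the universal tube $[p+q]$. -}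

module Defs where

open import Data.Nat as ℕ using (ℕ; zero; suc; _+_; _≤_)
open import Data.Bool using (Bool; true; false; _∧_; _∨_; not; T)
import Data.Bool as 𝔹
open import Data.Fin as Fin using (Fin; _↑ˡ_; _↑ʳ_)
import Data.Fin.Properties as FinP
open import Data.Fin.Subset using (Subset; ⁅_⁆; ⊤)
open import Data.Vec using (Vec; []; _∷_; lookup; tabulate)
import Data.Vec.Properties as VecP
open import Data.List using (List; []; _∷_; map; concatMap; filter; allFin; length; foldr; [_])
open import Data.Bool.ListAction using (any; all)
open import Data.List.Relation.Unary.All using (All)
open import Data.Product using (Σ; Σ-syntax; ∃; _×_; _,_; proj₁; proj₂)
open import Data.Sum using (_⊎_)
open import Data.Rational as ℚ using (ℚ; 0ℚ; 1ℚ)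
open import Relation.Binary.PropositionalEquality using (_≡_; _≢_; refl)
open import Relation.Nullary using (Dec; yes; no; ¬_)
open import Relation.Nullary.Decidable using (⌊_⌋; _×-dec_; _→-dec_)

allSubsets : (n : ℕ) → List (Subset n)
allSubsets zero    = [] ∷ []
allSubsets (suc n) = concatMap (λ s → (true ∷ s) ∷ (false ∷ s) ∷ []) (allSubsets n)

allVecs : (N k : ℕ) → List (Vec (Fin N) k)
allVecs N zero    = [] ∷ []
allVecs N (suc k) = concatMap (λ v → map (λ x → x ∷ v) (allFin N)) (allVecs N k)

_==ˢ_ : ∀ {n} → Subset n → Subset n → Bool
s ==ˢ t = ⌊ VecP.≡-dec 𝔹._≟_ s t ⌋

_==ᶠ_ : ∀ {n} → Fin n → Fin n → Bool
i ==ᶠ j = ⌊ i FinP.≟ j ⌋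

image : ∀ {q N} → (Fin q → Fin N) → Subset q → Subset N
image {q} f s = tabulate (λ j → any (λ i → lookup s i ∧ (f i ==ᶠ j)) (allFin q))

-- A set of subsets of [n], given by its (decidable) indicator function.
Fam : ℕ → Set
Fam n = Subset n → Bool

-- Tubes of E_n: the singletons and the universal tube [n].
IsTube : ∀ {n} → Subset n → Set
IsTube {n} t = (Σ[ i ∈ Fin n ] t ≡ ⁅ i ⁆) ⊎ (t ≡ ⊤)

card : ∀ {n} → Fam n → ℕ
card {n} T = length (filter (λ t → T t 𝔹.≟ true) (allSubsets n))

IsTubing : (n : ℕ) → Fam n → Set
IsTubing n T =
  (∀ t → T t ≡ true → IsTube t) ×
  (T ⊤ ≡ true) ×
  (2 ≤ n → ¬ (∀ (i : Fin n) → T ⁅ i ⁆ ≡ true))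

IsNTubing : (n : ℕ) → Fam n → Set
IsNTubing n T = IsTubing n T × (card T ≡ n)

D : ℕ → Set
D n = Σ (Fam n) (IsNTubing n)

-- Shuffles S^(p,q): permutations ι of [p+q] (as a vector of values)
-- increasing on the first p and on the last q positions.

IsShuffle : (p q : ℕ) → Vec (Fin (p + q)) (p + q) → Set
IsShuffle p q ι =
  (∀ (i j : Fin (p + q)) → lookup ι i ≡ lookup ι j → i ≡ j) ×
  (∀ (j : Fin (p + q)) → ∃ λ i → lookup ι i ≡ j) ×
  (∀ (i j : Fin p) → i Fin.< j → lookup ι (i ↑ˡ q) Fin.< lookup ι (j ↑ˡ q)) ×
  (∀ (i j : Fin q) → i Fin.< j → lookup ι (p ↑ʳ i) Fin.< lookup ι (p ↑ʳ j))

isShuffle? : (p q : ℕ) → (ι : Vec (Fin (p + q)) (p + q)) → Dec (IsShuffle p q ι)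
isShuffle? p q ι =
  FinP.all? (λ i → FinP.all? (λ j → (lookup ι i FinP.≟ lookup ι j) →-dec (i FinP.≟ j)))
  ×-dec FinP.all? (λ j → FinP.any? (λ i → lookup ι i FinP.≟ j))
  ×-dec FinP.all? (λ i → FinP.all? (λ j → (i FinP.<? j) →-dec (lookup ι (i ↑ˡ q) FinP.<? lookup ι (j ↑ˡ q))))
  ×-dec FinP.all? (λ i → FinP.all? (λ j → (i FinP.<? j) →-dec (lookup ι (p ↑ʳ i) FinP.<? lookup ι (p ↑ʳ j))))

shuffles : (p q : ℕ) → List (Vec (Fin (p + q)) (p + q))
shuffles p q = filter (isShuffle? p q) (allVecs (p + q) (p + q))

-- w_ι : singletons {ι(i)} (i ∈ [p]), the tubes ι̂(t) for non-universal
-- tubes t ∈ v, and the universal tube [p+q].  (u is not used.)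
w : ∀ {p q} → Fam p → Fam q → Vec (Fin (p + q)) (p + q) → Fam (p + q)
w {p} {q} u v ι t =
  any (λ i → t ==ˢ ⁅ lookup ι (i ↑ˡ q) ⁆) (allFin p)
  ∨ any (λ t′ → v t′ ∧ not (t′ ==ˢ ⊤) ∧ (t ==ˢ image (λ j → lookup ι (p ↑ʳ j)) t′)) (allSubsets q)
  ∨ (t ==ˢ ⊤)

-- ΔSym as formal ℚ-linear combinations of basis symbols.

-- raw basis symbols: the unit 1, or (n , F) standing for F_F with F ⊆ P([n])
data RawBasis : Set where
  one : RawBasis
  F   : (n : ℕ) → Fam n → RawBasis

data Basis : Set where
  one : Basis
  F   : (n : ℕ) → D n → Basis

deg : Basis → ℕ
deg one     = 0
deg (F n _) = n

Formal : Set
Formal = List (ℚ × RawBasis)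

Proper : RawBasis → Set
Proper one     = Data.Unit.⊤ where import Data.Unit
Proper (F n G) = IsNTubing n G

-- elements of ΔSym: formal sums of genuine basis elements
WF : Formal → Set
WF x = All (λ e → Proper (proj₂ e)) x

matches : RawBasis → Basis → Bool
matches one     one           = true
matches one     (F _ _)       = false
matches (F _ _) one           = false
matches (F m G) (F n (T , _)) with m ℕ.≟ n
... | yes refl = all (λ t → ⌊ G t 𝔹.≟ T t ⌋) (allSubsets n)
... | no _     = false

coeff : Formal → Basis → ℚ
coeff x b = foldr (λ e acc → (if matches (proj₂ e) b then proj₁ e else 0ℚ) ℚ.+ acc) 0ℚ x
  where open Data.Bool using (if_then_else_)

_≈_ : Formal → Formal → Set
x ≈ y = ∀ b → coeff x b ≡ coeff y b

_⊕_ : Formal → Formal → Formal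
x ⊕ y = x Data.List.++ y

_⊙_ : ℚ → Formal → Formal
c ⊙ x = map (λ e → (c ℚ.* proj₁ e , proj₂ e)) x

𝟙 : Formal
𝟙 = [ (1ℚ , one) ]

mulB : RawBasis → RawBasis → Formal
mulB one b = [ (1ℚ , b) ]
mulB (F p G) one = [ (1ℚ , F p G) ]
mulB (F p G) (F q H) = map (λ ι → (1ℚ , F (p + q) (w G H ι))) (shuffles p q)

_·_ : Formal → Formal → Formal
x · y = concatMap (λ e → concatMap (λ e′ → (proj₁ e ℚ.* proj₁ e′) ⊙ mulB (proj₂ e) (proj₂ e′)) y) x

Homog : ℕ → Formal → Set
Homog n x = ∀ b → deg b ≢ n → coeff x b ≡ 0ℚ

module Submission where

-- A basis element F_u of ΔSym is determined by a key: the degree n and the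
-- node m whose singleton is missing, since every n-tubing of E_n (n ≥ 1) is
-- tubing n m = {[n]} ∪ {{i} | i ≠ m} (classify-NTubing).  For v = tubing q m
-- one computes w_ι = tubing (p+q) (ι̂ m) (w≡tubing); this proves the first
-- claim and shows that F_u · F_v = Σ_ι F_(p+q, ι̂ m).  Shuffles ι ∈ S^(p,q)
-- correspond to Boolean words σ with p letters true and q letters false
-- (Shuffles), ι̂ m being the position of the m-th false of σ; so the product
-- of keys is a sum over words (mulKey), and associativity becomes an
-- identity between double sums over words, proved by passing through words
-- in three letters (pos-sum-assoc).
--
-- The remaining claims concern formal sums, compared coefficientwise.  We
-- evaluate a formal sum against functions of its raw symbols (eval); on
-- well-formed sums coefficients are evaluations at deltas of keys, and
-- sums with equal coefficients have equal evaluations against every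
-- function of keys (≈⇒eval-keys).  Bilinearity and the unit laws then hold
-- on evaluations, while associativity, compatibility with ≈ and gradedness
-- are read off from the product of keys.

open import Defs
open import Algebra.Structures using (IsCommutativeSemiring; IsCommutativeRing)
open import Data.Bool as 𝔹 using (Bool; true; false; not; _∧_; _∨_; if_then_else_)
open import Data.Empty using (⊥; ⊥-elim)
open import Data.Fin as Fin using (Fin; toℕ; fromℕ<; _↑ˡ_; _↑ʳ_; splitAt)
import Data.Fin.Properties as FinP
open import Data.List as List using (List; []; _∷_; _++_; map; concatMap; filter; allFin; length)
import Data.List.Properties as ListP
open import Data.List.Relation.Unary.All as All using (All; []; _∷_)
open import Data.Nat as ℕ using (ℕ; zero; suc)
import Data.Nat.Properties as ℕP
open import Data.Product using (Σ; Σ-syntax; ∃; _×_; _,_; proj₁; proj₂)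
open import Data.Rational as ℚ using (ℚ; 0ℚ; 1ℚ)
import Data.Rational.Properties as ℚP
open import Data.Sum using (_⊎_; inj₁; inj₂)
open import Data.Vec as Vec using (Vec; lookup)
import Data.Vec.Properties as VecP
open import Function using (id)
open import Relation.Binary.Definitions using (DecidableEquality)
open import Relation.Binary.PropositionalEquality
open import Relation.Nullary using (Dec; yes; no; ¬_)
open import Relation.Nullary.Decidable using (⌊_⌋)
open import Relation.Unary using (Decidable)

module Sums {A : Set} {plus times : A → A → A} {0# 1# : A}
            (isCS : IsCommutativeSemiring _≡_ plus times 0# 1#) where

  private
    infixl 6 _+_
    infixl 7 _*_
    _+_ _*_ : A → A → A
    _+_ = plus
    _*_ = times

  open IsCommutativeSemiring isCS
    using (+-assoc; +-comm; +-identityˡ; +-identityʳ; *-identityˡ; *-assoc; distribˡ)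
    renaming (zeroˡ to *-zeroˡ; zeroʳ to *-zeroʳ)

  +-interchange : ∀ a b c d → (a + b) + (c + d) ≡ (a + c) + (b + d)
  +-interchange a b c d = begin
      (a + b) + (c + d)  ≡⟨ +-assoc a b (c + d) ⟩
      a + (b + (c + d))  ≡⟨ cong (a +_) (sym (+-assoc b c d)) ⟩
      a + ((b + c) + d)  ≡⟨ cong (λ z → a + (z + d)) (+-comm b c) ⟩
      a + ((c + b) + d)  ≡⟨ cong (a +_) (+-assoc c b d) ⟩
      a + (c + (b + d))  ≡⟨ sym (+-assoc a c (b + d)) ⟩
      (a + c) + (b + d)  ∎
    where open ≡-Reasoning

  indB : Bool → A
  indB true  = 1#
  indB false = 0#

  ind : ∀ {p} {P : Set p} → Dec P → A
  ind d = indB ⌊ d ⌋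

  ind-yes : ∀ {p} {P : Set p} (d : Dec P) → P → ind d ≡ 1#
  ind-yes (yes _) _ = refl
  ind-yes (no ¬p) p = ⊥-elim (¬p p)

  ind-no : ∀ {p} {P : Set p} (d : Dec P) → ¬ P → ind d ≡ 0#
  ind-no (yes p) ¬p = ⊥-elim (¬p p)
  ind-no (no _)  _  = refl

  ind-⇔ : ∀ {p q} {P : Set p} {Q : Set q} (d : Dec P) (e : Dec Q) → (P → Q) → (Q → P) → ind d ≡ ind e
  ind-⇔ (yes p) e f g = sym (ind-yes e (f p))
  ind-⇔ (no ¬p) e f g = sym (ind-no e (λ q → ¬p (g q)))

  ind-× : ∀ {a b c} {P : Set a} {Q : Set b} {R : Set c} (dP : Dec P) (dQ : Dec Q) (dR : Dec R) →
          (R → P) → (R → Q) → (P → Q → R) → ind dR ≡ ind dP * ind dQ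
  ind-× (yes p) (yes q) dR f g h = trans (ind-yes dR (h p q)) (sym (*-identityˡ 1#))
  ind-× (yes p) (no ¬q) dR f g h = trans (ind-no dR (λ r → ¬q (g r))) (sym (*-zeroʳ 1#))
  ind-× (no ¬p) dQ dR f g h = trans (ind-no dR (λ r → ¬p (f r))) (sym (*-zeroˡ (ind dQ)))

  sumOver : ∀ {X : Set} → (X → A) → List X → A
  sumOver f []       = 0#
  sumOver f (x ∷ xs) = f x + sumOver f xs

  module _ {X : Set} where

    sumOver-cong : ∀ {f g : X → A} xs → (∀ x → f x ≡ g x) → sumOver f xs ≡ sumOver g xs
    sumOver-cong []       e = refl
    sumOver-cong (x ∷ xs) e = cong₂ _+_ (e x) (sumOver-cong xs e)

    sumOver-congAll : ∀ {f g : X → A} {xs} → All (λ x → f x ≡ g x) xs → sumOver f xs ≡ sumOver g xs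
    sumOver-congAll []       = refl
    sumOver-congAll (e ∷ es) = cong₂ _+_ e (sumOver-congAll es)

    sumOver-++ : ∀ (f : X → A) xs ys → sumOver f (xs ++ ys) ≡ sumOver f xs + sumOver f ys
    sumOver-++ f []       ys = sym (+-identityˡ _)
    sumOver-++ f (x ∷ xs) ys = trans (cong (f x +_) (sumOver-++ f xs ys)) (sym (+-assoc (f x) _ _))

    sumOver-+ : ∀ (f g : X → A) xs → sumOver (λ x → f x + g x) xs ≡ sumOver f xs + sumOver g xs
    sumOver-+ f g []       = sym (+-identityˡ 0#)
    sumOver-+ f g (x ∷ xs) = trans (cong (f x + g x +_) (sumOver-+ f g xs)) (+-interchange (f x) (g x) _ _)

    sumOver-* : ∀ c (f : X → A) xs → sumOver (λ x → c * f x) xs ≡ c * sumOver f xs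
    sumOver-* c f []       = sym (*-zeroʳ c)
    sumOver-* c f (x ∷ xs) = trans (cong (c * f x +_) (sumOver-* c f xs)) (sym (distribˡ c _ _))

    sumOver-0 : ∀ (xs : List X) → sumOver (λ _ → 0#) xs ≡ 0#
    sumOver-0 []       = refl
    sumOver-0 (x ∷ xs) = trans (+-identityˡ _) (sumOver-0 xs)

    sumOver-filter : ∀ {P : X → Set} (P? : Decidable P) (f : X → A) xs →
                     sumOver f (filter P? xs) ≡ sumOver (λ x → ind (P? x) * f x) xs
    sumOver-filter P? f [] = refl
    sumOver-filter P? f (x ∷ xs) with P? x
    ... | yes _ = cong₂ _+_ (sym (*-identityˡ (f x))) (sumOver-filter P? f xs)
    ... | no _  = trans (sumOver-filter P? f xs) (trans (sym (+-identityˡ _)) (cong (_+ sumOver (λ x → ind (P? x) * f x) xs) (sym (*-zeroˡ (f x)))))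

  sumOver-map : ∀ {X Y : Set} (f : Y → A) (g : X → Y) xs → sumOver f (map g xs) ≡ sumOver (λ x → f (g x)) xs
  sumOver-map f g []       = refl
  sumOver-map f g (x ∷ xs) = cong (f (g x) +_) (sumOver-map f g xs)

  sumOver-concatMap : ∀ {X Y : Set} (f : Y → A) (g : X → List Y) xs →
                      sumOver f (concatMap g xs) ≡ sumOver (λ x → sumOver f (g x)) xs
  sumOver-concatMap f g []       = refl
  sumOver-concatMap f g (x ∷ xs) = trans (sumOver-++ f (g x) (concatMap g xs)) (cong (sumOver f (g x) +_) (sumOver-concatMap f g xs))

  sumOver-swap : ∀ {X Y : Set} (h : X → Y → A) xs ys →
                 sumOver (λ x → sumOver (h x) ys) xs ≡ sumOver (λ y → sumOver (λ x → h x y) xs) ys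
  sumOver-swap h []       ys = sym (sumOver-0 ys)
  sumOver-swap h (x ∷ xs) ys =
    trans (cong (sumOver (h x) ys +_) (sumOver-swap h xs ys)) (sym (sumOver-+ (h x) (λ y → sumOver (λ x → h x y) xs) ys))

  -- xs enumerates X (each element exactly once): a δ-sum over xs evaluates its argument
  Enumerates : ∀ {X : Set} → DecidableEquality X → List X → Set
  Enumerates {X} _≟_ xs = ∀ x₀ (g : X → A) → sumOver (λ x → ind (x ≟ x₀) * g x) xs ≡ g x₀

  enumerates-allFin : ∀ n → Enumerates FinP._≟_ (allFin n)
  enumerates-allFin (suc n) x₀ g = begin
      sumOver (λ x → ind (x FinP.≟ x₀) * g x) (Fin.zero ∷ List.tabulate Fin.suc)
    ≡⟨ cong (λ xs → sumOver (λ x → ind (x FinP.≟ x₀) * g x) (Fin.zero ∷ xs)) (sym (ListP.map-tabulate id Fin.suc)) ⟩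
      ind (Fin.zero FinP.≟ x₀) * g Fin.zero + sumOver (λ x → ind (x FinP.≟ x₀) * g x) (map Fin.suc (allFin n))
    ≡⟨ cong (ind (Fin.zero FinP.≟ x₀) * g Fin.zero +_) (sumOver-map _ Fin.suc (allFin n)) ⟩
      ind (Fin.zero FinP.≟ x₀) * g Fin.zero + sumOver (λ x → ind (Fin.suc x FinP.≟ x₀) * g (Fin.suc x)) (allFin n)
    ≡⟨ split x₀ ⟩
      g x₀
    ∎
    where
    open ≡-Reasoning
    split : ∀ x₀ → ind (Fin.zero FinP.≟ x₀) * g Fin.zero + sumOver (λ x → ind (Fin.suc x FinP.≟ x₀) * g (Fin.suc x)) (allFin n) ≡ g x₀
    split Fin.zero = begin
        1# * g Fin.zero + sumOver (λ x → 0# * g (Fin.suc x)) (allFin n)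
      ≡⟨ cong₂ _+_ (*-identityˡ _) (trans (sumOver-cong (allFin n) (λ x → *-zeroˡ _)) (sumOver-0 (allFin n))) ⟩
        g Fin.zero + 0#
      ≡⟨ +-identityʳ _ ⟩
        g Fin.zero
      ∎
    split (Fin.suc y) = begin
        0# * g Fin.zero + sumOver (λ x → ind (Fin.suc x FinP.≟ Fin.suc y) * g (Fin.suc x)) (allFin n)
      ≡⟨ cong₂ _+_ (*-zeroˡ _) (sumOver-cong (allFin n) (λ x →
           cong (_* g (Fin.suc x)) (ind-⇔ (Fin.suc x FinP.≟ Fin.suc y) (x FinP.≟ y) FinP.suc-injective (cong Fin.suc)))) ⟩
        0# + sumOver (λ x → ind (x FinP.≟ y) * g (Fin.suc x)) (allFin n)
      ≡⟨ trans (+-identityˡ _) (enumerates-allFin n y (λ x → g (Fin.suc x))) ⟩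
        g (Fin.suc y)
      ∎

  -- all vectors of length k over an enumerated type, in the order used by Defs
  vecsOver : ∀ {X : Set} → List X → (k : ℕ) → List (Vec X k)
  vecsOver xs zero    = Vec.[] ∷ []
  vecsOver xs (suc k) = concatMap (λ v → map (Vec._∷ v) xs) (vecsOver xs k)

  enumerates-vecsOver : ∀ {X : Set} {_≟_ : DecidableEquality X} {xs : List X} →
                        Enumerates _≟_ xs → ∀ k → Enumerates (VecP.≡-dec _≟_) (vecsOver xs k)
  enumerates-vecsOver en zero Vec.[] g = trans (+-identityʳ _) (*-identityˡ (g Vec.[]))
  enumerates-vecsOver {_≟_ = _≟_} {xs} en (suc k) (x₀ Vec.∷ v₀) g = begin
      sumOver (λ u → ind (u ≟V (x₀ Vec.∷ v₀)) * g u) (vecsOver xs (suc k))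
    ≡⟨ sumOver-concatMap _ (λ v → map (Vec._∷ v) xs) (vecsOver xs k) ⟩
      sumOver (λ v → sumOver (λ u → ind (u ≟V (x₀ Vec.∷ v₀)) * g u) (map (Vec._∷ v) xs)) (vecsOver xs k)
    ≡⟨ sumOver-cong (vecsOver xs k) inner ⟩
      sumOver (λ v → ind (v ≟V v₀) * g (x₀ Vec.∷ v)) (vecsOver xs k)
    ≡⟨ enumerates-vecsOver en k v₀ (λ v → g (x₀ Vec.∷ v)) ⟩
      g (x₀ Vec.∷ v₀)
    ∎
    where
    open ≡-Reasoning
    _≟V_ : ∀ {m} → DecidableEquality (Vec _ m)
    _≟V_ = VecP.≡-dec _≟_
    cons-ind : ∀ x v → ind ((x Vec.∷ v) ≟V (x₀ Vec.∷ v₀)) ≡ ind (v ≟V v₀) * ind (x ≟ x₀)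
    cons-ind x v = ind-× (v ≟V v₀) (x ≟ x₀) ((x Vec.∷ v) ≟V (x₀ Vec.∷ v₀))
                     (λ e → proj₂ (VecP.∷-injective e)) (λ e → proj₁ (VecP.∷-injective e)) (λ e₁ e₂ → cong₂ Vec._∷_ e₂ e₁)
    inner : ∀ v → sumOver (λ u → ind (u ≟V (x₀ Vec.∷ v₀)) * g u) (map (Vec._∷ v) xs) ≡ ind (v ≟V v₀) * g (x₀ Vec.∷ v)
    inner v = begin
        sumOver (λ u → ind (u ≟V (x₀ Vec.∷ v₀)) * g u) (map (Vec._∷ v) xs)
      ≡⟨ sumOver-map _ (Vec._∷ v) xs ⟩
        sumOver (λ x → ind ((x Vec.∷ v) ≟V (x₀ Vec.∷ v₀)) * g (x Vec.∷ v)) xs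
      ≡⟨ sumOver-cong xs (λ x → trans (cong (_* g (x Vec.∷ v)) (cons-ind x v)) (*-assoc (ind (v ≟V v₀)) (ind (x ≟ x₀)) (g (x Vec.∷ v)))) ⟩
        sumOver (λ x → ind (v ≟V v₀) * (ind (x ≟ x₀) * g (x Vec.∷ v))) xs
      ≡⟨ sumOver-* (ind (v ≟V v₀)) _ xs ⟩
        ind (v ≟V v₀) * sumOver (λ x → ind (x ≟ x₀) * g (x Vec.∷ v)) xs
      ≡⟨ cong (ind (v ≟V v₀) *_) (en x₀ (λ x → g (x Vec.∷ v))) ⟩
        ind (v ≟V v₀) * g (x₀ Vec.∷ v)
      ∎

  enumerates-bools : Enumerates 𝔹._≟_ (true ∷ false ∷ [])
  enumerates-bools true  g = begin
      1# * g true + (0# * g false + 0#)  ≡⟨ cong₂ _+_ (*-identityˡ (g true)) (trans (+-identityʳ _) (*-zeroˡ (g false))) ⟩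
      g true + 0#                        ≡⟨ +-identityʳ (g true) ⟩
      g true                             ∎
    where open ≡-Reasoning
  enumerates-bools false g = begin
      0# * g true + (1# * g false + 0#)  ≡⟨ cong₂ _+_ (*-zeroˡ (g true)) (trans (+-identityʳ _) (*-identityˡ (g false))) ⟩
      0# + g false                       ≡⟨ +-identityˡ (g false) ⟩
      g false                            ∎
    where open ≡-Reasoning

  allVecs≡vecsOver : ∀ N k → allVecs N k ≡ vecsOver (allFin N) k
  allVecs≡vecsOver N zero    = refl
  allVecs≡vecsOver N (suc k) = cong (concatMap (λ v → map (Vec._∷ v) (allFin N))) (allVecs≡vecsOver N k)

  allSubsets≡vecsOver : ∀ n → allSubsets n ≡ vecsOver (true ∷ false ∷ []) n
  allSubsets≡vecsOver zero    = refl
  allSubsets≡vecsOver (suc n) = cong (concatMap (λ v → map (Vec._∷ v) (true ∷ false ∷ []))) (allSubsets≡vecsOver n)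

  enumerates-allVecs : ∀ N k → Enumerates (VecP.≡-dec FinP._≟_) (allVecs N k)
  enumerates-allVecs N k =
    subst (Enumerates (VecP.≡-dec FinP._≟_)) (sym (allVecs≡vecsOver N k)) (enumerates-vecsOver (enumerates-allFin N) k)

  enumerates-allSubsets : ∀ n → Enumerates (VecP.≡-dec 𝔹._≟_) (allSubsets n)
  enumerates-allSubsets n =
    subst (Enumerates (VecP.≡-dec 𝔹._≟_)) (sym (allSubsets≡vecsOver n)) (enumerates-vecsOver enumerates-bools n)

-- A shuffle of [p] and [q] is encoded by the word σ whose
-- k-th letter says whether position k is taken by the first block
-- (true) or by the second block (false); pos b σ i is the position of the
-- i-th occurrence of the letter b in σ.
module Words where

  open import Data.Nat using (_+_; _<_; z≤n; s≤s)
  open import Relation.Binary.Definitions using (tri<; tri≈; tri>)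

  sameLetter : Bool → Bool → Bool
  sameLetter true  true  = true
  sameLetter true  false = false
  sameLetter false true  = false
  sameLetter false false = true

  cnt : Bool → List Bool → ℕ
  cnt b []      = 0
  cnt b (x ∷ σ) with sameLetter x b
  ... | true  = suc (cnt b σ)
  ... | false = cnt b σ

  Shape : ℕ → ℕ → List Bool → Set
  Shape p q σ = cnt true σ ≡ p × cnt false σ ≡ q

  -- position of the i-th occurrence of b (meaningful for i < cnt b σ)
  pos : Bool → List Bool → ℕ → ℕ
  pos b []      i = 0
  pos b (x ∷ σ) zero with sameLetter x b
  ... | true  = 0
  ... | false = suc (pos b σ zero)
  pos b (x ∷ σ) (suc i) with sameLetter x b
  ... | true  = suc (pos b σ i)
  ... | false = suc (pos b σ (suc i))

  at : List Bool → ℕ → Bool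
  at []      k       = false
  at (x ∷ σ) zero    = x
  at (x ∷ σ) (suc k) = at σ k

  letter-view : ∀ x b → x ≡ b ⊎ x ≡ not b
  letter-view true  true  = inj₁ refl
  letter-view true  false = inj₂ refl
  letter-view false true  = inj₂ refl
  letter-view false false = inj₁ refl

  cnt-hit : ∀ b σ → cnt b (b ∷ σ) ≡ suc (cnt b σ)
  cnt-hit true  σ = refl
  cnt-hit false σ = refl

  cnt-miss : ∀ b σ → cnt b (not b ∷ σ) ≡ cnt b σ
  cnt-miss true  σ = refl
  cnt-miss false σ = refl

  pos-hit-zero : ∀ b σ → pos b (b ∷ σ) 0 ≡ 0
  pos-hit-zero true  σ = refl
  pos-hit-zero false σ = refl

  pos-hit-suc : ∀ b σ i → pos b (b ∷ σ) (suc i) ≡ suc (pos b σ i)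
  pos-hit-suc true  σ i = refl
  pos-hit-suc false σ i = refl

  pos-miss : ∀ b σ i → pos b (not b ∷ σ) i ≡ suc (pos b σ i)
  pos-miss true  σ zero    = refl
  pos-miss true  σ (suc i) = refl
  pos-miss false σ zero    = refl
  pos-miss false σ (suc i) = refl

  not-≢ : ∀ b → not b ≢ b
  not-≢ true  ()
  not-≢ false ()

  length-cnt : ∀ σ → length σ ≡ cnt true σ + cnt false σ
  length-cnt []          = refl
  length-cnt (true ∷ σ)  = cong suc (length-cnt σ)
  length-cnt (false ∷ σ) = trans (cong suc (length-cnt σ)) (sym (ℕP.+-suc (cnt true σ) (cnt false σ)))

  shape-length : ∀ {p q} σ → Shape p q σ → length σ ≡ p + q
  shape-length σ (e₁ , e₂) = trans (length-cnt σ) (cong₂ _+_ e₁ e₂)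

  pos-bound : ∀ b σ i → i < cnt b σ → pos b σ i < length σ
  pos-bound b [] i ()
  pos-bound b (x ∷ σ) i lt with letter-view x b
  pos-bound b (.b ∷ σ) zero lt | inj₁ refl rewrite pos-hit-zero b σ = s≤s z≤n
  pos-bound b (.b ∷ σ) (suc i) lt | inj₁ refl rewrite pos-hit-suc b σ i | cnt-hit b σ = s≤s (pos-bound b σ i (ℕP.≤-pred lt))
  pos-bound b (.(not b) ∷ σ) i lt | inj₂ refl rewrite pos-miss b σ i | cnt-miss b σ = s≤s (pos-bound b σ i lt)

  pos-at : ∀ b σ i → i < cnt b σ → at σ (pos b σ i) ≡ b
  pos-at b [] i ()
  pos-at b (x ∷ σ) i lt with letter-view x b
  pos-at b (.b ∷ σ) zero lt | inj₁ refl rewrite pos-hit-zero b σ = refl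
  pos-at b (.b ∷ σ) (suc i) lt | inj₁ refl rewrite pos-hit-suc b σ i | cnt-hit b σ = pos-at b σ i (ℕP.≤-pred lt)
  pos-at b (.(not b) ∷ σ) i lt | inj₂ refl rewrite pos-miss b σ i | cnt-miss b σ = pos-at b σ i lt

  pos-mono : ∀ b σ i j → i < j → j < cnt b σ → pos b σ i < pos b σ j
  pos-mono b [] i j ij ()
  pos-mono b (x ∷ σ) i j ij lt with letter-view x b
  pos-mono b (.b ∷ σ) zero (suc j) ij lt | inj₁ refl rewrite pos-hit-zero b σ | pos-hit-suc b σ j = s≤s z≤n
  pos-mono b (.b ∷ σ) (suc i) (suc j) ij lt | inj₁ refl rewrite pos-hit-suc b σ i | pos-hit-suc b σ j | cnt-hit b σ =
    s≤s (pos-mono b σ i j (ℕP.≤-pred ij) (ℕP.≤-pred lt))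
  pos-mono b (.(not b) ∷ σ) i j ij lt | inj₂ refl rewrite pos-miss b σ i | pos-miss b σ j | cnt-miss b σ =
    s≤s (pos-mono b σ i j ij lt)

  pos-surj : ∀ b σ k → k < length σ → at σ k ≡ b → Σ[ i ∈ ℕ ] (i < cnt b σ × pos b σ i ≡ k)
  pos-surj b [] k () e
  pos-surj b (x ∷ σ) k lt e with letter-view x b
  pos-surj b (.b ∷ σ) zero lt e | inj₁ refl rewrite cnt-hit b σ = 0 , s≤s z≤n , pos-hit-zero b σ
  pos-surj b (.b ∷ σ) (suc k) lt e | inj₁ refl with pos-surj b σ k (ℕP.≤-pred lt) e
  ... | i , ilt , pe rewrite cnt-hit b σ = suc i , s≤s ilt , trans (pos-hit-suc b σ i) (cong suc pe)
  pos-surj b (.(not b) ∷ σ) zero lt e | inj₂ refl = ⊥-elim (not-≢ b e)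
  pos-surj b (.(not b) ∷ σ) (suc k) lt e | inj₂ refl with pos-surj b σ k (ℕP.≤-pred lt) e
  ... | i , ilt , pe rewrite cnt-miss b σ = i , ilt , trans (pos-miss b σ i) (cong suc pe)

  pos-injective : ∀ b σ i j → i < cnt b σ → j < cnt b σ → pos b σ i ≡ pos b σ j → i ≡ j
  pos-injective b σ i j li lj e with ℕP.<-cmp i j
  ... | tri≈ _ ij _ = ij
  ... | tri< ij _ _ = ⊥-elim (ℕP.<-irrefl e (pos-mono b σ i j ij lj))
  ... | tri> _ _ ji = ⊥-elim (ℕP.<-irrefl (sym e) (pos-mono b σ j i ji li))

  at-ext : ∀ (σ τ : List Bool) → length σ ≡ length τ → (∀ k → k < length σ → at σ k ≡ at τ k) → σ ≡ τ
  at-ext []      []      e f = refl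
  at-ext (x ∷ σ) (y ∷ τ) e f = cong₂ _∷_ (f 0 (s≤s z≤n)) (at-ext σ τ (ℕP.suc-injective e) (λ k lt → f (suc k) (s≤s lt)))

  record IsEnumeration (b : Bool) (σ : List Bool) (c : ℕ) (g : Fin c → ℕ) : Set where
    field
      bound      : ∀ i → g i < length σ
      hits       : ∀ i → at σ (g i) ≡ b
      increasing : ∀ i j → i Fin.< j → g i < g j
      covers     : ∀ k → k < length σ → at σ k ≡ b → Σ[ i ∈ Fin c ] g i ≡ k

  open IsEnumeration

  private
    pred-suc : ∀ {n} → 0 < n → n ≡ suc (ℕ.pred n)
    pred-suc {suc n} _ = refl

  enumeration-hit : ∀ {b σ c g} → IsEnumeration b (b ∷ σ) (suc c) g →
                    g Fin.zero ≡ 0 × IsEnumeration b σ c (λ i → ℕ.pred (g (Fin.suc i)))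
  enumeration-hit {b} {σ} {c} {g} en = g0 , record
    { bound      = λ i → ℕP.≤-pred (subst (_< suc (length σ)) (gs i) (bound en (Fin.suc i)))
    ; hits       = λ i → subst (λ z → at (b ∷ σ) z ≡ b) (gs i) (hits en (Fin.suc i))
    ; increasing = λ i j lt → ℕP.≤-pred (subst₂ _<_ (gs i) (gs j) (increasing en (Fin.suc i) (Fin.suc j) (s≤s lt)))
    ; covers     = λ k lt e → shift k (covers en (suc k) (s≤s lt) e)
    }
    where
    first : ∀ i → g i ≡ 0 → g Fin.zero ≡ 0
    first Fin.zero    e = e
    first (Fin.suc i) e = ⊥-elim (ℕP.n≮0 (subst (g Fin.zero <_) e (increasing en Fin.zero (Fin.suc i) (s≤s z≤n))))
    g0 : g Fin.zero ≡ 0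
    g0 = let (i₀ , e₀) = covers en 0 (s≤s z≤n) refl in first i₀ e₀
    gs : ∀ i → g (Fin.suc i) ≡ suc (ℕ.pred (g (Fin.suc i)))
    gs i = pred-suc (subst (_< g (Fin.suc i)) g0 (increasing en Fin.zero (Fin.suc i) (s≤s z≤n)))
    shift : ∀ k → Σ[ i ∈ Fin (suc c) ] g i ≡ suc k → Σ[ i ∈ Fin c ] ℕ.pred (g (Fin.suc i)) ≡ k
    shift k (Fin.zero  , e) = ⊥-elim (ℕP.1+n≢0 (trans (sym e) g0))
    shift k (Fin.suc i , e) = i , ℕP.suc-injective (trans (sym (gs i)) e)

  enumeration-miss : ∀ {b σ c g} → IsEnumeration b (not b ∷ σ) c g →
                     (∀ i → g i ≡ suc (ℕ.pred (g i))) × IsEnumeration b σ c (λ i → ℕ.pred (g i))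
  enumeration-miss {b} {σ} {c} {g} en = gs , record
    { bound      = λ i → ℕP.≤-pred (subst (_< suc (length σ)) (gs i) (bound en i))
    ; hits       = λ i → subst (λ z → at (not b ∷ σ) z ≡ b) (gs i) (hits en i)
    ; increasing = λ i j lt → ℕP.≤-pred (subst₂ _<_ (gs i) (gs j) (increasing en i j lt))
    ; covers     = λ k lt e → let (i , e′) = covers en (suc k) (s≤s lt) e in i , ℕP.suc-injective (trans (sym (gs i)) e′)
    }
    where
    positive : ∀ i → 0 < g i
    positive i with g i in e
    ... | zero  = ⊥-elim (not-≢ b (subst (λ z → at (not b ∷ σ) z ≡ b) e (hits en i)))
    ... | suc _ = s≤s z≤n
    gs : ∀ i → g i ≡ suc (ℕ.pred (g i))
    gs i = pred-suc (positive i)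

  enumeration-unique : ∀ b σ c g → IsEnumeration b σ c g → cnt b σ ≡ c × (∀ i → pos b σ (toℕ i) ≡ g i)
  enumeration-unique b [] zero    g en = refl , λ ()
  enumeration-unique b [] (suc c) g en = ⊥-elim (ℕP.n≮0 (bound en Fin.zero))
  enumeration-unique b (x ∷ σ) c g en with letter-view x b
  enumeration-unique b (.b ∷ σ) zero g en | inj₁ refl with covers en 0 (s≤s z≤n) refl
  ... | () , _
  enumeration-unique b (.b ∷ σ) (suc c) g en | inj₁ refl =
    trans (cnt-hit b σ) (cong suc (proj₁ IH)) , positions
    where
    g′ : Fin c → ℕ
    g′ i = ℕ.pred (g (Fin.suc i))
    hit : g Fin.zero ≡ 0 × IsEnumeration b σ c g′
    hit = enumeration-hit en
    IH : cnt b σ ≡ c × (∀ i → pos b σ (toℕ i) ≡ g′ i)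
    IH = enumeration-unique b σ c g′ (proj₂ hit)
    positions : ∀ i → pos b (b ∷ σ) (toℕ i) ≡ g i
    positions Fin.zero    = trans (pos-hit-zero b σ) (sym (proj₁ hit))
    positions (Fin.suc i) = trans (pos-hit-suc b σ (toℕ i)) (trans (cong suc (proj₂ IH i))
      (sym (pred-suc (subst (_< g (Fin.suc i)) (proj₁ hit) (increasing en Fin.zero (Fin.suc i) (s≤s z≤n))))))
  enumeration-unique b (.(not b) ∷ σ) c g en | inj₂ refl =
    trans (cnt-miss b σ) (proj₁ IH) , λ i → trans (pos-miss b σ (toℕ i)) (trans (cong suc (proj₂ IH i)) (sym (proj₁ miss i)))
    where
    g′ : Fin c → ℕ
    g′ i = ℕ.pred (g i)
    miss : (∀ i → g i ≡ suc (g′ i)) × IsEnumeration b σ c g′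
    miss = enumeration-miss en
    IH : cnt b σ ≡ c × (∀ i → pos b σ (toℕ i) ≡ g′ i)
    IH = enumeration-unique b σ c g′ (proj₂ miss)

module ℚΣ = Sums (IsCommutativeRing.isCommutativeSemiring ℚP.+-*-isCommutativeRing)

-- Sums over all words of a given shape, and the reindexing identity
-- behind associativity: a word in three letters A, B, C can be built by
-- first separating {A, B} from C and then A from B, or by first
-- separating A from {B, C} and then B from C; both ways enumerate the
-- same words, with the same positions of the letters C.
module WordSums where

  open import Data.Nat using (_+_; _<_)
  open ℚΣ
  open Words

  sumWords : ℕ → ℕ → (List Bool → ℚ) → ℚ
  sumWords zero    zero    h = h []
  sumWords (suc a) zero    h = sumWords a zero (λ σ → h (true ∷ σ))
  sumWords zero    (suc b) h = sumWords zero b (λ σ → h (false ∷ σ))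
  sumWords (suc a) (suc b) h = sumWords a (suc b) (λ σ → h (true ∷ σ)) ℚ.+ sumWords (suc a) b (λ σ → h (false ∷ σ))

  sumWords-congShape : ∀ a b {h h′ : List Bool → ℚ} → (∀ σ → Shape a b σ → h σ ≡ h′ σ) → sumWords a b h ≡ sumWords a b h′
  sumWords-congShape zero    zero    e = e [] (refl , refl)
  sumWords-congShape (suc a) zero    e = sumWords-congShape a zero (λ σ v → e (true ∷ σ) (cong suc (proj₁ v) , proj₂ v))
  sumWords-congShape zero    (suc b) e = sumWords-congShape zero b (λ σ v → e (false ∷ σ) (proj₁ v , cong suc (proj₂ v)))
  sumWords-congShape (suc a) (suc b) e = cong₂ ℚ._+_
    (sumWords-congShape a (suc b) (λ σ v → e (true ∷ σ) (cong suc (proj₁ v) , proj₂ v)))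
    (sumWords-congShape (suc a) b (λ σ v → e (false ∷ σ) (proj₁ v , cong suc (proj₂ v))))

  sumWords-cong : ∀ a b {h h′ : List Bool → ℚ} → (∀ σ → h σ ≡ h′ σ) → sumWords a b h ≡ sumWords a b h′
  sumWords-cong a b e = sumWords-congShape a b (λ σ _ → e σ)

  sumWords-+ : ∀ a b (h h′ : List Bool → ℚ) → sumWords a b (λ σ → h σ ℚ.+ h′ σ) ≡ sumWords a b h ℚ.+ sumWords a b h′
  sumWords-+ zero    zero    h h′ = refl
  sumWords-+ (suc a) zero    h h′ = sumWords-+ a zero (λ σ → h (true ∷ σ)) (λ σ → h′ (true ∷ σ))
  sumWords-+ zero    (suc b) h h′ = sumWords-+ zero b (λ σ → h (false ∷ σ)) (λ σ → h′ (false ∷ σ))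
  sumWords-+ (suc a) (suc b) h h′ =
    trans (cong₂ ℚ._+_ (sumWords-+ a (suc b) (λ σ → h (true ∷ σ)) (λ σ → h′ (true ∷ σ)))
                       (sumWords-+ (suc a) b (λ σ → h (false ∷ σ)) (λ σ → h′ (false ∷ σ))))
          (+-interchange (sumWords a (suc b) (λ σ → h (true ∷ σ))) (sumWords a (suc b) (λ σ → h′ (true ∷ σ)))
                         (sumWords (suc a) b (λ σ → h (false ∷ σ))) (sumWords (suc a) b (λ σ → h′ (false ∷ σ))))

  sumWords-* : ∀ a b c (h : List Bool → ℚ) → sumWords a b (λ σ → c ℚ.* h σ) ≡ c ℚ.* sumWords a b h
  sumWords-* zero    zero    c h = refl
  sumWords-* (suc a) zero    c h = sumWords-* a zero c (λ σ → h (true ∷ σ))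
  sumWords-* zero    (suc b) c h = sumWords-* zero b c (λ σ → h (false ∷ σ))
  sumWords-* (suc a) (suc b) c h =
    trans (cong₂ ℚ._+_ (sumWords-* a (suc b) c (λ σ → h (true ∷ σ))) (sumWords-* (suc a) b c (λ σ → h (false ∷ σ))))
          (sym (ℚP.*-distribˡ-+ c _ _))

  sumWords-0 : ∀ a b → sumWords a b (λ _ → 0ℚ) ≡ 0ℚ
  sumWords-0 a b = begin
      sumWords a b (λ _ → 0ℚ)            ≡⟨ sumWords-cong a b (λ _ → sym (ℚP.*-zeroˡ 0ℚ)) ⟩
      sumWords a b (λ _ → 0ℚ ℚ.* 0ℚ)     ≡⟨ sumWords-* a b 0ℚ (λ _ → 0ℚ) ⟩
      0ℚ ℚ.* sumWords a b (λ _ → 0ℚ)     ≡⟨ ℚP.*-zeroˡ (sumWords a b (λ _ → 0ℚ)) ⟩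
      0ℚ                                 ∎
    where open ≡-Reasoning

  sumWords-sumOver : ∀ {X : Set} a b (h : List Bool → X → ℚ) xs →
                     sumWords a b (λ σ → sumOver (h σ) xs) ≡ sumOver (λ x → sumWords a b (λ σ → h σ x)) xs
  sumWords-sumOver a b h []       = sumWords-0 a b
  sumWords-sumOver a b h (x ∷ xs) = trans (sumWords-+ a b _ _) (cong (sumWords a b (λ σ → h σ x) ℚ.+_) (sumWords-sumOver a b h xs))

  sumWords-swap : ∀ a b c d (f : List Bool → List Bool → ℚ) →
                  sumWords a b (λ σ → sumWords c d (λ τ → f σ τ)) ≡ sumWords c d (λ τ → sumWords a b (λ σ → f σ τ))
  sumWords-swap zero    zero    c d f = refl
  sumWords-swap (suc a) zero    c d f = sumWords-swap a zero c d (λ σ → f (true ∷ σ))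
  sumWords-swap zero    (suc b) c d f = sumWords-swap zero b c d (λ σ → f (false ∷ σ))
  sumWords-swap (suc a) (suc b) c d f =
    trans (cong₂ ℚ._+_ (sumWords-swap a (suc b) c d (λ σ → f (true ∷ σ))) (sumWords-swap (suc a) b c d (λ σ → f (false ∷ σ))))
          (sym (sumWords-+ c d (λ τ → sumWords a (suc b) (λ σ → f (true ∷ σ) τ)) (λ τ → sumWords (suc a) b (λ σ → f (false ∷ σ) τ))))

  infix 4 _≟W_
  _≟W_ : DecidableEquality (List Bool)
  _≟W_ = ListP.≡-dec 𝔹._≟_

  private
    ind-cons-same : ∀ x σ σ₀ → ind ((x ∷ σ) ≟W (x ∷ σ₀)) ≡ ind (σ ≟W σ₀)
    ind-cons-same x σ σ₀ = ind-⇔ ((x ∷ σ) ≟W (x ∷ σ₀)) (σ ≟W σ₀) ListP.∷-injectiveʳ (cong (x ∷_))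

    ind-true-false : ∀ σ σ₀ → ind ((false ∷ σ) ≟W (true ∷ σ₀)) ≡ 0ℚ
    ind-true-false σ σ₀ = ind-no ((false ∷ σ) ≟W (true ∷ σ₀)) (λ ())

    ind-false-true : ∀ σ σ₀ → ind ((true ∷ σ) ≟W (false ∷ σ₀)) ≡ 0ℚ
    ind-false-true σ σ₀ = ind-no ((true ∷ σ) ≟W (false ∷ σ₀)) (λ ())

  sumWords-once : ∀ a b σ₀ → Shape a b σ₀ → sumWords a b (λ σ → ind (σ ≟W σ₀)) ≡ 1ℚ
  sumWords-once zero    zero    []           _ = refl
  sumWords-once zero    zero    (true ∷ σ₀)  (() , _)
  sumWords-once zero    zero    (false ∷ σ₀) (_ , ())
  sumWords-once (suc a) b       []           (() , _)
  sumWords-once zero    (suc b) []           (_ , ())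
  sumWords-once zero    b       (true ∷ σ₀)  (() , _)
  sumWords-once a       zero    (false ∷ σ₀) (_ , ())
  sumWords-once (suc a) zero    (true ∷ σ₀) (v₁ , v₂) =
    trans (sumWords-cong a zero (λ σ → ind-cons-same true σ σ₀)) (sumWords-once a zero σ₀ (ℕP.suc-injective v₁ , v₂))
  sumWords-once zero    (suc b) (false ∷ σ₀) (v₁ , v₂) =
    trans (sumWords-cong zero b (λ σ → ind-cons-same false σ σ₀)) (sumWords-once zero b σ₀ (v₁ , ℕP.suc-injective v₂))
  sumWords-once (suc a) (suc b) (true ∷ σ₀) (v₁ , v₂) = begin
      sumWords a (suc b) (λ σ → ind ((true ∷ σ) ≟W (true ∷ σ₀))) ℚ.+ sumWords (suc a) b (λ σ → ind ((false ∷ σ) ≟W (true ∷ σ₀)))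
    ≡⟨ cong₂ ℚ._+_ (sumWords-cong a (suc b) (λ σ → ind-cons-same true σ σ₀))
                   (trans (sumWords-cong (suc a) b (λ σ → ind-true-false σ σ₀)) (sumWords-0 (suc a) b)) ⟩
      sumWords a (suc b) (λ σ → ind (σ ≟W σ₀)) ℚ.+ 0ℚ
    ≡⟨ trans (ℚP.+-identityʳ _) (sumWords-once a (suc b) σ₀ (ℕP.suc-injective v₁ , v₂)) ⟩
      1ℚ
    ∎
    where open ≡-Reasoning
  sumWords-once (suc a) (suc b) (false ∷ σ₀) (v₁ , v₂) = begin
      sumWords a (suc b) (λ σ → ind ((true ∷ σ) ≟W (false ∷ σ₀))) ℚ.+ sumWords (suc a) b (λ σ → ind ((false ∷ σ) ≟W (false ∷ σ₀)))
    ≡⟨ cong₂ ℚ._+_ (trans (sumWords-cong a (suc b) (λ σ → ind-false-true σ σ₀)) (sumWords-0 a (suc b)))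
                   (sumWords-cong (suc a) b (λ σ → ind-cons-same false σ σ₀)) ⟩
      0ℚ ℚ.+ sumWords (suc a) b (λ σ → ind (σ ≟W σ₀))
    ≡⟨ trans (ℚP.+-identityˡ _) (sumWords-once (suc a) b σ₀ (v₁ , ℕP.suc-injective v₂)) ⟩
      1ℚ
    ∎
    where open ≡-Reasoning

  data Letter : Set where
    A B C : Letter

  posC : List Letter → ℕ → ℕ
  posC []      c       = 0
  posC (A ∷ w) c       = suc (posC w c)
  posC (B ∷ w) c       = suc (posC w c)
  posC (C ∷ w) zero    = 0
  posC (C ∷ w) (suc c) = suc (posC w c)

  -- σ separates A (true) from {B, C} (false); τ then splits the latter into B and C
  merge : List Bool → List Bool → List Letter
  merge []          τ           = []
  merge (true ∷ σ)  τ           = A ∷ merge σ τ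
  merge (false ∷ σ) []          = []
  merge (false ∷ σ) (true ∷ τ)  = B ∷ merge σ τ
  merge (false ∷ σ) (false ∷ τ) = C ∷ merge σ τ

  -- σ separates {A, B} (true) from C (false); τ then splits the former into A and B
  merge′ : List Bool → List Bool → List Letter
  merge′ []          τ           = []
  merge′ (false ∷ σ) τ           = C ∷ merge′ σ τ
  merge′ (true ∷ σ)  []          = []
  merge′ (true ∷ σ)  (true ∷ τ)  = A ∷ merge′ σ τ
  merge′ (true ∷ σ)  (false ∷ τ) = B ∷ merge′ σ τ

  posC-merge : ∀ σ τ c → length τ ≡ cnt false σ → c < cnt false τ → posC (merge σ τ) c ≡ pos false σ (pos false τ c)
  posC-merge [] [] c e ()
  posC-merge [] (_ ∷ _) c () lt
  posC-merge (true ∷ σ) τ c e lt = trans (cong suc (posC-merge σ τ c e lt)) (sym (pos-miss false σ _))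
  posC-merge (false ∷ σ) [] c () lt
  posC-merge (false ∷ σ) (true ∷ τ) c e lt = trans (cong suc (posC-merge σ τ c (ℕP.suc-injective e) lt))
    (sym (trans (cong (pos false (false ∷ σ)) (pos-miss false τ c)) (pos-hit-suc false σ _)))
  posC-merge (false ∷ σ) (false ∷ τ) zero    e lt = refl
  posC-merge (false ∷ σ) (false ∷ τ) (suc c) e lt = cong suc (posC-merge σ τ c (ℕP.suc-injective e) (ℕP.≤-pred lt))

  posC-merge′ : ∀ σ τ c → length τ ≡ cnt true σ → posC (merge′ σ τ) c ≡ pos false σ c
  posC-merge′ []          τ           c       e  = refl
  posC-merge′ (false ∷ σ) τ           zero    e  = refl
  posC-merge′ (false ∷ σ) τ           (suc c) e  = cong suc (posC-merge′ σ τ c e)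
  posC-merge′ (true ∷ σ)  []          c       ()
  posC-merge′ (true ∷ σ)  (true ∷ τ)  c       e  = trans (cong suc (posC-merge′ σ τ c (ℕP.suc-injective e))) (sym (pos-miss false σ c))
  posC-merge′ (true ∷ σ)  (false ∷ τ) c       e  = trans (cong suc (posC-merge′ σ τ c (ℕP.suc-injective e))) (sym (pos-miss false σ c))

  sumWords₃ : ℕ → ℕ → ℕ → (List Letter → ℚ) → ℚ
  sumWords₃ zero    zero    zero    h = h []
  sumWords₃ (suc p) zero    zero    h = sumWords₃ p 0 0 (λ w → h (A ∷ w))
  sumWords₃ zero    (suc q) zero    h = sumWords₃ 0 q 0 (λ w → h (B ∷ w))
  sumWords₃ zero    zero    (suc r) h = sumWords₃ 0 0 r (λ w → h (C ∷ w))
  sumWords₃ (suc p) (suc q) zero    h = sumWords₃ p (suc q) 0 (λ w → h (A ∷ w)) ℚ.+ sumWords₃ (suc p) q 0 (λ w → h (B ∷ w))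
  sumWords₃ (suc p) zero    (suc r) h = sumWords₃ p 0 (suc r) (λ w → h (A ∷ w)) ℚ.+ sumWords₃ (suc p) 0 r (λ w → h (C ∷ w))
  sumWords₃ zero    (suc q) (suc r) h = sumWords₃ 0 q (suc r) (λ w → h (B ∷ w)) ℚ.+ sumWords₃ 0 (suc q) r (λ w → h (C ∷ w))
  sumWords₃ (suc p) (suc q) (suc r) h =
    sumWords₃ p (suc q) (suc r) (λ w → h (A ∷ w)) ℚ.+
    (sumWords₃ (suc p) q (suc r) (λ w → h (B ∷ w)) ℚ.+ sumWords₃ (suc p) (suc q) r (λ w → h (C ∷ w)))

  private
    sumWords-shape : ∀ {a a′ b b′} h → a ≡ a′ → b ≡ b′ → sumWords a b h ≡ sumWords a′ b′ h
    sumWords-shape h refl refl = refl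

  -- merge is a bijection W(p, q + r) × W(q, r) ≅ W(p, q, r)
  sumWords-merge : ∀ p q r h → sumWords p (q + r) (λ σ → sumWords q r (λ τ → h (merge σ τ))) ≡ sumWords₃ p q r h
  sumWords-merge zero    zero    zero    h = refl
  sumWords-merge (suc p) zero    zero    h = sumWords-merge p 0 0 (λ w → h (A ∷ w))
  sumWords-merge zero    (suc q) zero    h = sumWords-merge 0 q 0 (λ w → h (B ∷ w))
  sumWords-merge zero    zero    (suc r) h = sumWords-merge 0 0 r (λ w → h (C ∷ w))
  sumWords-merge (suc p) (suc q) zero    h = cong₂ ℚ._+_ (sumWords-merge p (suc q) 0 (λ w → h (A ∷ w))) (sumWords-merge (suc p) q 0 (λ w → h (B ∷ w)))
  sumWords-merge (suc p) zero    (suc r) h = cong₂ ℚ._+_ (sumWords-merge p 0 (suc r) (λ w → h (A ∷ w))) (sumWords-merge (suc p) 0 r (λ w → h (C ∷ w)))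
  sumWords-merge zero    (suc q) (suc r) h =
    trans (sumWords-+ 0 (q + suc r) (λ σ → sumWords q (suc r) (λ τ → h (B ∷ merge σ τ))) (λ σ → sumWords (suc q) r (λ τ → h (C ∷ merge σ τ))))
    (cong₂ ℚ._+_ (sumWords-merge 0 q (suc r) (λ w → h (B ∷ w)))
       (trans (sumWords-shape {a = 0} (λ σ → sumWords (suc q) r (λ τ → h (C ∷ merge σ τ))) refl (ℕP.+-suc q r)) (sumWords-merge 0 (suc q) r (λ w → h (C ∷ w)))))
  sumWords-merge (suc p) (suc q) (suc r) h =
    cong₂ ℚ._+_ (sumWords-merge p (suc q) (suc r) (λ w → h (A ∷ w)))
    (trans (sumWords-+ (suc p) (q + suc r) (λ σ → sumWords q (suc r) (λ τ → h (B ∷ merge σ τ))) (λ σ → sumWords (suc q) r (λ τ → h (C ∷ merge σ τ))))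
    (cong₂ ℚ._+_ (sumWords-merge (suc p) q (suc r) (λ w → h (B ∷ w)))
       (trans (sumWords-shape {a = suc p} (λ σ → sumWords (suc q) r (λ τ → h (C ∷ merge σ τ))) refl (ℕP.+-suc q r)) (sumWords-merge (suc p) (suc q) r (λ w → h (C ∷ w))))))

  -- merge′ is a bijection W(p + q, r) × W(p, q) ≅ W(p, q, r)
  sumWords-merge′ : ∀ p q r h → sumWords (p + q) r (λ σ → sumWords p q (λ τ → h (merge′ σ τ))) ≡ sumWords₃ p q r h
  sumWords-merge′ zero    zero    zero    h = refl
  sumWords-merge′ (suc p) zero    zero    h = sumWords-merge′ p 0 0 (λ w → h (A ∷ w))
  sumWords-merge′ zero    (suc q) zero    h = sumWords-merge′ 0 q 0 (λ w → h (B ∷ w))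
  sumWords-merge′ zero    zero    (suc r) h = sumWords-merge′ 0 0 r (λ w → h (C ∷ w))
  sumWords-merge′ (suc p) (suc q) zero    h =
    trans (sumWords-+ (p + suc q) 0 (λ σ → sumWords p (suc q) (λ τ → h (A ∷ merge′ σ τ))) (λ σ → sumWords (suc p) q (λ τ → h (B ∷ merge′ σ τ))))
    (cong₂ ℚ._+_ (sumWords-merge′ p (suc q) 0 (λ w → h (A ∷ w)))
       (trans (sumWords-shape {b = 0} (λ σ → sumWords (suc p) q (λ τ → h (B ∷ merge′ σ τ))) (ℕP.+-suc p q) refl) (sumWords-merge′ (suc p) q 0 (λ w → h (B ∷ w)))))
  sumWords-merge′ (suc p) zero    (suc r) h = cong₂ ℚ._+_ (sumWords-merge′ p 0 (suc r) (λ w → h (A ∷ w))) (sumWords-merge′ (suc p) 0 r (λ w → h (C ∷ w)))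
  sumWords-merge′ zero    (suc q) (suc r) h = cong₂ ℚ._+_ (sumWords-merge′ 0 q (suc r) (λ w → h (B ∷ w))) (sumWords-merge′ 0 (suc q) r (λ w → h (C ∷ w)))
  sumWords-merge′ (suc p) (suc q) (suc r) h = begin
      sumWords (p + suc q) (suc r) (λ σ → hA σ ℚ.+ hB σ) ℚ.+ SC
    ≡⟨ cong (ℚ._+ SC) (sumWords-+ (p + suc q) (suc r) hA hB) ⟩
      (SA ℚ.+ SB) ℚ.+ SC
    ≡⟨ ℚP.+-assoc SA SB SC ⟩
      SA ℚ.+ (SB ℚ.+ SC)
    ≡⟨ cong₂ ℚ._+_ (sumWords-merge′ p (suc q) (suc r) (λ w → h (A ∷ w)))
         (cong₂ ℚ._+_ (trans (sumWords-shape {b = suc r} hB (ℕP.+-suc p q) refl) (sumWords-merge′ (suc p) q (suc r) (λ w → h (B ∷ w))))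
                      (sumWords-merge′ (suc p) (suc q) r (λ w → h (C ∷ w)))) ⟩
      sumWords₃ (suc p) (suc q) (suc r) h
    ∎
    where
    open ≡-Reasoning
    hA hB : List Bool → ℚ
    hA σ = sumWords p (suc q) (λ τ → h (A ∷ merge′ σ τ))
    hB σ = sumWords (suc p) q (λ τ → h (B ∷ merge′ σ τ))
    SA SB SC : ℚ
    SA = sumWords (p + suc q) (suc r) hA
    SB = sumWords (p + suc q) (suc r) hB
    SC = sumWords (suc p + suc q) r (λ σ → sumWords (suc p) (suc q) (λ τ → h (C ∷ merge′ σ τ)))

  -- the reindexing identity behind associativity (c < r): both sides sum
  -- g over the words in A, B, C of shape (p, q, r), evaluated at the
  -- position of the c-th letter C; the left side first separates {A, B}
  -- from C (merge′), the right side first separates A from {B, C} (merge)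
  pos-sum-assoc : ∀ p q r c (g : ℕ → ℚ) → c < r →
    sumWords p q (λ _ → sumWords (p + q) r (λ σ′ → g (pos false σ′ c)))
    ≡ sumWords q r (λ τ → sumWords p (q + r) (λ σ → g (pos false σ (pos false τ c))))
  pos-sum-assoc p q r c g lt = begin
      sumWords p q (λ _ → sumWords (p + q) r (λ σ′ → g (pos false σ′ c)))
    ≡⟨ sumWords-swap p q (p + q) r (λ τ σ → g (pos false σ c)) ⟩
      sumWords (p + q) r (λ σ → sumWords p q (λ τ → g (pos false σ c)))
    ≡⟨ sumWords-congShape (p + q) r (λ σ vσ → sumWords-congShape p q (λ τ vτ →
         cong g (sym (posC-merge′ σ τ c (trans (shape-length τ vτ) (sym (proj₁ vσ))))))) ⟩
      sumWords (p + q) r (λ σ → sumWords p q (λ τ → g (posC (merge′ σ τ) c)))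
    ≡⟨ sumWords-merge′ p q r (λ w → g (posC w c)) ⟩
      sumWords₃ p q r (λ w → g (posC w c))
    ≡⟨ sym (sumWords-merge p q r (λ w → g (posC w c))) ⟩
      sumWords p (q + r) (λ σ → sumWords q r (λ τ → g (posC (merge σ τ) c)))
    ≡⟨ sumWords-congShape p (q + r) (λ σ vσ → sumWords-congShape q r (λ τ vτ →
         cong g (posC-merge σ τ c (trans (shape-length τ vτ) (sym (proj₂ vσ))) (subst (c <_) (sym (proj₂ vτ)) lt)))) ⟩
      sumWords p (q + r) (λ σ → sumWords q r (λ τ → g (pos false σ (pos false τ c))))
    ≡⟨ sumWords-swap p (q + r) q r (λ σ τ → g (pos false σ (pos false τ c))) ⟩
      sumWords q r (λ τ → sumWords p (q + r) (λ σ → g (pos false σ (pos false τ c))))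
    ∎
    where open ≡-Reasoning

-- The word σ of shape (p, q) determines the shuffle
-- sending i ∈ [p] to the position of the i-th true and j ∈ [q] to the
-- position of the j-th false; conversely every shuffle arises from exactly
-- one word.
module Shuffles where

  open import Data.Nat using (_+_; _<_)
  open import Data.Sum using ([_,_]′)
  open ℚΣ
  open Words
  open WordSums

  -- a natural number below n as an element of Fin n (d is a dummy default)
  clamp : ∀ {n} → Fin n → ℕ → Fin n
  clamp {n} d x with x ℕ.<? n
  ... | yes lt = fromℕ< lt
  ... | no _   = d

  toℕ-clamp : ∀ {n} (d : Fin n) x → x < n → toℕ (clamp d x) ≡ x
  toℕ-clamp {n} d x lt with x ℕ.<? n
  ... | yes lt′ = FinP.toℕ-fromℕ< lt′
  ... | no ¬lt  = ⊥-elim (¬lt lt)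

  splitView : ∀ p q (k : Fin (p + q)) → (Σ[ i ∈ Fin p ] k ≡ i ↑ˡ q) ⊎ (Σ[ j ∈ Fin q ] k ≡ p ↑ʳ j)
  splitView p q k with splitAt p k in e
  ... | inj₁ i = inj₁ (i , sym (FinP.splitAt⁻¹-↑ˡ e))
  ... | inj₂ j = inj₂ (j , sym (FinP.splitAt⁻¹-↑ʳ e))

  posOf : ∀ p q → List Bool → Fin (p + q) → ℕ
  posOf p q σ k = [ (λ i → pos true σ (toℕ i)) , (λ j → pos false σ (toℕ j)) ]′ (splitAt p k)

  shuffleOf : ∀ p q → List Bool → Vec (Fin (p + q)) (p + q)
  shuffleOf p q σ = Vec.tabulate (λ k → clamp k (posOf p q σ k))

  module _ {p q : ℕ} (σ : List Bool) (v : Shape p q σ) where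

    below-true : ∀ (i : Fin p) → toℕ i < cnt true σ
    below-true i = subst (toℕ i <_) (sym (proj₁ v)) (FinP.toℕ<n i)

    below-false : ∀ (j : Fin q) → toℕ j < cnt false σ
    below-false j = subst (toℕ j <_) (sym (proj₂ v)) (FinP.toℕ<n j)

    shuffleOf-left : ∀ (i : Fin p) → toℕ (lookup (shuffleOf p q σ) (i ↑ˡ q)) ≡ pos true σ (toℕ i)
    shuffleOf-left i rewrite VecP.lookup∘tabulate (λ k → clamp k (posOf p q σ k)) (i ↑ˡ q) | FinP.splitAt-↑ˡ p i q =
      toℕ-clamp (i ↑ˡ q) _ (subst (pos true σ (toℕ i) <_) (shape-length σ v) (pos-bound true σ (toℕ i) (below-true i)))

    shuffleOf-right : ∀ (j : Fin q) → toℕ (lookup (shuffleOf p q σ) (p ↑ʳ j)) ≡ pos false σ (toℕ j)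
    shuffleOf-right j rewrite VecP.lookup∘tabulate (λ k → clamp k (posOf p q σ k)) (p ↑ʳ j) | FinP.splitAt-↑ʳ p q j =
      toℕ-clamp (p ↑ʳ j) _ (subst (pos false σ (toℕ j) <_) (shape-length σ v) (pos-bound false σ (toℕ j) (below-false j)))

    private
      ι : Vec (Fin (p + q)) (p + q)
      ι = shuffleOf p q σ

      below-length : ∀ (k : Fin (p + q)) → toℕ k < length σ
      below-length k = subst (toℕ k <_) (sym (shape-length σ v)) (FinP.toℕ<n k)

      -- a position cannot hold both a true and a false
      left≢right : ∀ i j → pos true σ (toℕ i) ≢ pos false σ (toℕ j)
      left≢right i j e = not-≢ false (trans (sym (pos-at true σ (toℕ i) (below-true i)))
                                            (trans (cong (at σ) e) (pos-at false σ (toℕ j) (below-false j))))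

    shuffleOf-injective-values : ∀ (a b : Fin (p + q)) → lookup ι a ≡ lookup ι b → a ≡ b
    shuffleOf-injective-values a b e with splitView p q a | splitView p q b
    ... | inj₁ (i , refl) | inj₁ (i′ , refl) =
      cong (_↑ˡ q) (FinP.toℕ-injective (pos-injective true σ (toℕ i) (toℕ i′) (below-true i) (below-true i′)
        (trans (sym (shuffleOf-left i)) (trans (cong toℕ e) (shuffleOf-left i′)))))
    ... | inj₁ (i , refl) | inj₂ (j , refl) =
      ⊥-elim (left≢right i j (trans (sym (shuffleOf-left i)) (trans (cong toℕ e) (shuffleOf-right j))))
    ... | inj₂ (j , refl) | inj₁ (i , refl) =
      ⊥-elim (left≢right i j (trans (sym (shuffleOf-left i)) (trans (cong toℕ (sym e)) (shuffleOf-right j))))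
    ... | inj₂ (j , refl) | inj₂ (j′ , refl) =
      cong (p ↑ʳ_) (FinP.toℕ-injective (pos-injective false σ (toℕ j) (toℕ j′) (below-false j) (below-false j′)
        (trans (sym (shuffleOf-right j)) (trans (cong toℕ e) (shuffleOf-right j′)))))

    -- every position k holds some letter, whose occurrence number gives the preimage of k
    shuffleOf-surjective : ∀ (k : Fin (p + q)) → ∃ λ a → lookup ι a ≡ k
    shuffleOf-surjective k with at σ (toℕ k) in e
    ... | true with pos-surj true σ (toℕ k) (below-length k) e
    ... | i , ilt , pe = fromℕ< ilt′ ↑ˡ q ,
          FinP.toℕ-injective (trans (shuffleOf-left (fromℕ< ilt′)) (trans (cong (pos true σ) (FinP.toℕ-fromℕ< ilt′)) pe))
      where
      ilt′ : i < p
      ilt′ = subst (i <_) (proj₁ v) ilt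
    shuffleOf-surjective k | false with pos-surj false σ (toℕ k) (below-length k) e
    ... | j , jlt , pe = p ↑ʳ fromℕ< jlt′ ,
          FinP.toℕ-injective (trans (shuffleOf-right (fromℕ< jlt′)) (trans (cong (pos false σ) (FinP.toℕ-fromℕ< jlt′)) pe))
      where
      jlt′ : j < q
      jlt′ = subst (j <_) (proj₂ v) jlt

    shuffleOf-isShuffle : IsShuffle p q (shuffleOf p q σ)
    shuffleOf-isShuffle = shuffleOf-injective-values , shuffleOf-surjective , monoˡ , monoʳ
      where
      monoˡ : ∀ (i j : Fin p) → i Fin.< j → lookup ι (i ↑ˡ q) Fin.< lookup ι (j ↑ˡ q)
      monoˡ i j lt = subst₂ _<_ (sym (shuffleOf-left i)) (sym (shuffleOf-left j)) (pos-mono true σ (toℕ i) (toℕ j) lt (below-true j))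
      monoʳ : ∀ (i j : Fin q) → i Fin.< j → lookup ι (p ↑ʳ i) Fin.< lookup ι (p ↑ʳ j)
      monoʳ i j lt = subst₂ _<_ (sym (shuffleOf-right i)) (sym (shuffleOf-right j)) (pos-mono false σ (toℕ i) (toℕ j) lt (below-false j))

  shuffleOf-injective : ∀ {p q} {σ σ′ : List Bool} → Shape p q σ → Shape p q σ′ → shuffleOf p q σ ≡ shuffleOf p q σ′ → σ ≡ σ′
  shuffleOf-injective {p} {q} {σ} {σ′} v v′ e =
    at-ext σ σ′ (trans (shape-length σ v) (sym (shape-length σ′ v′))) same-letter
    where
    same-true : ∀ i → i < p → pos true σ i ≡ pos true σ′ i
    same-true i lt = trans (cong (pos true σ) (sym (FinP.toℕ-fromℕ< lt)))
      (trans (sym (shuffleOf-left σ v (fromℕ< lt))) (trans (cong (λ w → toℕ (lookup w (fromℕ< lt ↑ˡ q))) e)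
        (trans (shuffleOf-left σ′ v′ (fromℕ< lt)) (cong (pos true σ′) (FinP.toℕ-fromℕ< lt)))))
    same-false : ∀ j → j < q → pos false σ j ≡ pos false σ′ j
    same-false j lt = trans (cong (pos false σ) (sym (FinP.toℕ-fromℕ< lt)))
      (trans (sym (shuffleOf-right σ v (fromℕ< lt))) (trans (cong (λ w → toℕ (lookup w (p ↑ʳ fromℕ< lt))) e)
        (trans (shuffleOf-right σ′ v′ (fromℕ< lt)) (cong (pos false σ′) (FinP.toℕ-fromℕ< lt)))))
    same-letter : ∀ k → k < length σ → at σ k ≡ at σ′ k
    same-letter k lt with at σ k in ek
    ... | true with pos-surj true σ k lt ek
    ... | i , ilt , pe = sym (trans (cong (at σ′) (trans (sym pe) (same-true i ilt′))) (pos-at true σ′ i (subst (i <_) (sym (proj₁ v′)) ilt′)))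
      where
      ilt′ : i < p
      ilt′ = subst (i <_) (proj₁ v) ilt
    same-letter k lt | false with pos-surj false σ k lt ek
    ... | j , jlt , pe = sym (trans (cong (at σ′) (trans (sym pe) (same-false j jlt′))) (pos-at false σ′ j (subst (j <_) (sym (proj₂ v′)) jlt′)))
      where
      jlt′ : j < q
      jlt′ = subst (j <_) (proj₂ v) jlt

  at-tabulate : ∀ {n} (f : Fin n → Bool) (k : Fin n) → at (List.tabulate f) (toℕ k) ≡ f k
  at-tabulate f Fin.zero    = refl
  at-tabulate f (Fin.suc k) = at-tabulate (λ i → f (Fin.suc i)) k

  vec-ext : ∀ {X : Set} {n} (u v : Vec X n) → (∀ k → lookup u k ≡ lookup v k) → u ≡ v
  vec-ext u v e = trans (sym (VecP.tabulate∘lookup u)) (trans (VecP.tabulate-cong e) (VecP.tabulate∘lookup v))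

  isFirstBlock : ∀ {p q} → Fin p ⊎ Fin q → Bool
  isFirstBlock (inj₁ _) = true
  isFirstBlock (inj₂ _) = false

  -- every shuffle is the shuffle of a word: letter k records whether
  -- k is the image of the first block
  module _ {p q : ℕ} (ι : Vec (Fin (p + q)) (p + q)) (sh : IsShuffle p q ι) where

    private
      inv : Fin (p + q) → Fin (p + q)
      inv k = proj₁ (proj₁ (proj₂ sh) k)
      ι-inv : ∀ k → lookup ι (inv k) ≡ k
      ι-inv k = proj₂ (proj₁ (proj₂ sh) k)
      inv-ι : ∀ x → inv (lookup ι x) ≡ x
      inv-ι x = proj₁ sh _ _ (ι-inv (lookup ι x))
      letter : Fin (p + q) → Bool
      letter k = isFirstBlock (splitAt p (inv k))

    wordOf : List Bool
    wordOf = List.tabulate letter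

    private
      length-wordOf : length wordOf ≡ p + q
      length-wordOf = ListP.length-tabulate letter
      position : ∀ k → k < length wordOf → Fin (p + q)
      position k lt = fromℕ< (subst (k <_) length-wordOf lt)
      at-wordOf : ∀ k (lt : k < length wordOf) → at wordOf k ≡ letter (position k lt)
      at-wordOf k lt = trans (cong (at wordOf) (sym (FinP.toℕ-fromℕ< (subst (k <_) length-wordOf lt)))) (at-tabulate letter _)
      origin : ∀ k → (Σ[ i ∈ Fin p ] lookup ι (i ↑ˡ q) ≡ k × letter k ≡ true) ⊎ (Σ[ j ∈ Fin q ] lookup ι (p ↑ʳ j) ≡ k × letter k ≡ false)
      origin k with splitView p q (inv k)
      ... | inj₁ (i , e) = inj₁ (i , trans (cong (lookup ι) (sym e)) (ι-inv k) , cong isFirstBlock (trans (cong (splitAt p) e) (FinP.splitAt-↑ˡ p i q)))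
      ... | inj₂ (j , e) = inj₂ (j , trans (cong (lookup ι) (sym e)) (ι-inv k) , cong isFirstBlock (trans (cong (splitAt p) e) (FinP.splitAt-↑ʳ p q j)))
      letter-left : ∀ i → letter (lookup ι (i ↑ˡ q)) ≡ true
      letter-left i = trans (cong (λ z → isFirstBlock (splitAt p z)) (inv-ι (i ↑ˡ q))) (cong isFirstBlock (FinP.splitAt-↑ˡ p i q))
      letter-right : ∀ j → letter (lookup ι (p ↑ʳ j)) ≡ false
      letter-right j = trans (cong (λ z → isFirstBlock (splitAt p z)) (inv-ι (p ↑ʳ j))) (cong isFirstBlock (FinP.splitAt-↑ʳ p q j))
      below-length : ∀ (k : Fin (p + q)) → toℕ k < length wordOf
      below-length k = subst (toℕ k <_) (sym length-wordOf) (FinP.toℕ<n k)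

      left-enumeration : IsEnumeration true wordOf p (λ i → toℕ (lookup ι (i ↑ˡ q)))
      left-enumeration = record
        { bound      = λ i → below-length _
        ; hits       = λ i → trans (at-tabulate letter _) (letter-left i)
        ; increasing = proj₁ (proj₂ (proj₂ sh))
        ; covers     = covers
        }
        where
        covers : ∀ k → k < length wordOf → at wordOf k ≡ true → Σ[ i ∈ Fin p ] toℕ (lookup ι (i ↑ˡ q)) ≡ k
        covers k lt e with origin (position k lt)
        ... | inj₁ (i , ei , _)  = i , trans (cong toℕ ei) (FinP.toℕ-fromℕ< _)
        ... | inj₂ (j , _ , lj) = ⊥-elim (not-≢ true (trans (sym lj) (trans (sym (at-wordOf k lt)) e)))

      right-enumeration : IsEnumeration false wordOf q (λ j → toℕ (lookup ι (p ↑ʳ j)))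
      right-enumeration = record
        { bound      = λ j → below-length _
        ; hits       = λ j → trans (at-tabulate letter _) (letter-right j)
        ; increasing = proj₂ (proj₂ (proj₂ sh))
        ; covers     = covers
        }
        where
        covers : ∀ k → k < length wordOf → at wordOf k ≡ false → Σ[ j ∈ Fin q ] toℕ (lookup ι (p ↑ʳ j)) ≡ k
        covers k lt e with origin (position k lt)
        ... | inj₂ (j , ej , _)  = j , trans (cong toℕ ej) (FinP.toℕ-fromℕ< _)
        ... | inj₁ (i , _ , li) = ⊥-elim (not-≢ false (trans (sym li) (trans (sym (at-wordOf k lt)) e)))

      left : cnt true wordOf ≡ p × (∀ i → pos true wordOf (toℕ i) ≡ toℕ (lookup ι (i ↑ˡ q)))
      left = enumeration-unique true wordOf p _ left-enumeration
      right : cnt false wordOf ≡ q × (∀ j → pos false wordOf (toℕ j) ≡ toℕ (lookup ι (p ↑ʳ j)))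
      right = enumeration-unique false wordOf q _ right-enumeration

    wordOf-shape : Shape p q wordOf
    wordOf-shape = proj₁ left , proj₁ right

    shuffleOf-wordOf : shuffleOf p q wordOf ≡ ι
    shuffleOf-wordOf = vec-ext _ _ agree
      where
      agree : ∀ k → lookup (shuffleOf p q wordOf) k ≡ lookup ι k
      agree k with splitView p q k
      ... | inj₁ (i , refl) = FinP.toℕ-injective (trans (shuffleOf-left wordOf wordOf-shape i) (proj₂ left i))
      ... | inj₂ (j , refl) = FinP.toℕ-injective (trans (shuffleOf-right wordOf wordOf-shape j) (proj₂ right j))

  infix 4 _≟V_
  _≟V_ : ∀ {N k} → DecidableEquality (Vec (Fin N) k)
  _≟V_ = VecP.≡-dec FinP._≟_

  -- a vector is a shuffle iff it is the shuffle of (exactly one) word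
  ind-isShuffle : ∀ p q (v : Vec (Fin (p + q)) (p + q)) → ind (isShuffle? p q v) ≡ sumWords p q (λ σ → ind (v ≟V shuffleOf p q σ))
  ind-isShuffle p q v with isShuffle? p q v
  ... | yes sh = sym (trans
        (sumWords-congShape p q (λ σ vσ → ind-⇔ (v ≟V shuffleOf p q σ) (σ ≟W wordOf v sh)
          (λ e → shuffleOf-injective vσ (wordOf-shape v sh) (trans (sym e) (sym (shuffleOf-wordOf v sh))))
          (λ e → trans (sym (shuffleOf-wordOf v sh)) (cong (shuffleOf p q) (sym e)))))
        (sumWords-once p q (wordOf v sh) (wordOf-shape v sh)))
  ... | no ¬sh = sym (trans
        (sumWords-congShape p q (λ σ vσ → ind-no (v ≟V shuffleOf p q σ) (λ e → ¬sh (subst (IsShuffle p q) (sym e) (shuffleOf-isShuffle σ vσ)))))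
        (sumWords-0 p q))

  sumOver-shuffles : ∀ p q (f : Vec (Fin (p + q)) (p + q) → ℚ) → sumOver f (shuffles p q) ≡ sumWords p q (λ σ → f (shuffleOf p q σ))
  sumOver-shuffles p q f = begin
      sumOver f (shuffles p q)
    ≡⟨ sumOver-filter (isShuffle? p q) f vecs ⟩
      sumOver (λ v → ind (isShuffle? p q v) ℚ.* f v) vecs
    ≡⟨ sumOver-cong vecs (λ v → trans (cong (ℚ._* f v) (ind-isShuffle p q v)) (ℚP.*-comm _ (f v))) ⟩
      sumOver (λ v → f v ℚ.* sumWords p q (λ σ → ind (v ≟V shuffleOf p q σ))) vecs
    ≡⟨ sumOver-cong vecs (λ v → trans (sym (sumWords-* p q (f v) _)) (sumWords-cong p q (λ σ → ℚP.*-comm (f v) _))) ⟩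
      sumOver (λ v → sumWords p q (λ σ → ind (v ≟V shuffleOf p q σ) ℚ.* f v)) vecs
    ≡⟨ sym (sumWords-sumOver p q (λ σ v → ind (v ≟V shuffleOf p q σ) ℚ.* f v) vecs) ⟩
      sumWords p q (λ σ → sumOver (λ v → ind (v ≟V shuffleOf p q σ) ℚ.* f v) vecs)
    ≡⟨ sumWords-cong p q (λ σ → enumerates-allVecs (p + q) (p + q) (shuffleOf p q σ) f) ⟩
      sumWords p q (λ σ → f (shuffleOf p q σ))
    ∎
    where
    open ≡-Reasoning
    vecs : List (Vec (Fin (p + q)) (p + q))
    vecs = allVecs (p + q) (p + q)

module ℕΣ = Sums ℕP.+-*-isCommutativeSemiring

-- For n ≥ 1 they are exactly the families
-- tubing n m  =  {[n]} ∪ {{i} | i ≠ m},  one for each node m (the node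
-- whose singleton is missing); and w_ι for u ∈ D_p, v = tubing q m is
-- tubing (p + q) (ι̂ m).  In particular w_ι is a (p+q)-tubing, and the
-- missing node, computed by missing, is all that matters about a basis
-- element F_u.
module Tubings where

  open import Data.Nat using (_+_; _*_; _≤_; _<_; z≤n; s≤s)
  open import Data.Bool.ListAction using (any; all)
  open import Data.Fin.Subset using (Subset; ⁅_⁆; ⊤)
  import Data.Fin.Subset.Properties as SubsetP
  open import Data.List.Membership.Propositional using (_∈_)
  import Data.List.Membership.Propositional.Properties as MemP
  open import Data.List.Relation.Unary.Any using (Any; here; there)
  import Data.Bool.Properties as BoolP
  open ℕΣ
  open Shuffles using (splitView; vec-ext)

  bool-ext : ∀ {a b : Bool} → (a ≡ true → b ≡ true) → (b ≡ true → a ≡ true) → a ≡ b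
  bool-ext {true}  {true}  f g = refl
  bool-ext {true}  {false} f g = sym (f refl)
  bool-ext {false} {true}  f g = g refl
  bool-ext {false} {false} f g = refl

  ∨-split : ∀ {a b} → a ∨ b ≡ true → a ≡ true ⊎ b ≡ true
  ∨-split {true}  e = inj₁ refl
  ∨-split {false} e = inj₂ e

  ∨-introˡ : ∀ {a} b → a ≡ true → a ∨ b ≡ true
  ∨-introˡ b refl = refl

  ∨-introʳ : ∀ a {b} → b ≡ true → a ∨ b ≡ true
  ∨-introʳ true  e = refl
  ∨-introʳ false e = e

  ∧-split : ∀ {a b} → a ∧ b ≡ true → a ≡ true × b ≡ true
  ∧-split {true} e = refl , e

  ∧-intro : ∀ {a b} → a ≡ true → b ≡ true → a ∧ b ≡ true
  ∧-intro refl e = e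

  not-true : ∀ {a} → not a ≡ true → a ≡ false
  not-true {false} e = refl

  not-intro : ∀ {a} → a ≡ false → not a ≡ true
  not-intro refl = refl

  true≢false : true ≢ false
  true≢false ()

  ==ˢ-true : ∀ {n} {s t : Subset n} → (s ==ˢ t) ≡ true → s ≡ t
  ==ˢ-true {s = s} {t} e with VecP.≡-dec 𝔹._≟_ s t
  ... | yes p = p

  ==ˢ-intro : ∀ {n} {s t : Subset n} → s ≡ t → (s ==ˢ t) ≡ true
  ==ˢ-intro {s = s} refl with VecP.≡-dec 𝔹._≟_ s s
  ... | yes _ = refl
  ... | no ¬p = ⊥-elim (¬p refl)

  ==ᶠ-true : ∀ {n} {i j : Fin n} → (i ==ᶠ j) ≡ true → i ≡ j
  ==ᶠ-true {i = i} {j} e with i FinP.≟ j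
  ... | yes p = p

  ==ᶠ-intro : ∀ {n} {i j : Fin n} → i ≡ j → (i ==ᶠ j) ≡ true
  ==ᶠ-intro {i = i} refl with i FinP.≟ i
  ... | yes _ = refl
  ... | no ¬p = ⊥-elim (¬p refl)

  ==ᶠ-false : ∀ {n} {i j : Fin n} → i ≢ j → (i ==ᶠ j) ≡ false
  ==ᶠ-false ne = BoolP.¬-not (λ e → ne (==ᶠ-true e))

  any-intro : ∀ {X : Set} {f : X → Bool} {x xs} → x ∈ xs → f x ≡ true → any f xs ≡ true
  any-intro {f = f} {xs = y ∷ ys} (here refl) e = ∨-introˡ _ e
  any-intro {f = f} {xs = y ∷ ys} (there m)   e = ∨-introʳ (f y) (any-intro m e)

  any-elim : ∀ {X : Set} (f : X → Bool) xs → any f xs ≡ true → Σ[ x ∈ X ] f x ≡ true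
  any-elim f (y ∷ ys) e with ∨-split {f y} e
  ... | inj₁ e′ = y , e′
  ... | inj₂ e′ = any-elim f ys e′

  all-elim : ∀ {X : Set} (f : X → Bool) {x} xs → all f xs ≡ true → x ∈ xs → f x ≡ true
  all-elim f (y ∷ ys) e (here refl) = proj₁ (∧-split e)
  all-elim f (y ∷ ys) e (there m)   = all-elim f ys (proj₂ (∧-split {f y} e)) m

  all-intro : ∀ {X : Set} (f : X → Bool) xs → (∀ x → f x ≡ true) → all f xs ≡ true
  all-intro f []       h = refl
  all-intro f (y ∷ ys) h = ∧-intro (h y) (all-intro f ys h)

  ∈-allSubsets : ∀ n (s : Subset n) → s ∈ allSubsets n
  ∈-allSubsets zero    Vec.[]        = here refl
  ∈-allSubsets (suc n) (b Vec.∷ s) =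
    MemP.∈-concatMap⁺ (λ s → (true Vec.∷ s) ∷ (false Vec.∷ s) ∷ []) (extend b (∈-allSubsets n s))
    where
    extend : ∀ b {xs} → s ∈ xs → Any (λ t → (b Vec.∷ s) ∈ ((true Vec.∷ t) ∷ (false Vec.∷ t) ∷ [])) xs
    extend true  (here refl) = here (here refl)
    extend false (here refl) = here (there (here refl))
    extend b     (there m)   = there (extend b m)

  lookup-⁅⁆ : ∀ {n} (i j : Fin n) → lookup ⁅ j ⁆ i ≡ true → i ≡ j
  lookup-⁅⁆ i j e = SubsetP.x∈⁅y⁆⇒x≡y j (VecP.lookup⇒[]= i ⁅ j ⁆ e)

  lookup-⁅⁆-self : ∀ {n} (j : Fin n) → lookup ⁅ j ⁆ j ≡ true
  lookup-⁅⁆-self j = VecP.[]=⇒lookup (SubsetP.x∈⁅x⁆ j)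

  ⁅⁆-injective : ∀ {n} {i j : Fin n} → ⁅ i ⁆ ≡ ⁅ j ⁆ → i ≡ j
  ⁅⁆-injective {i = i} {j} e = lookup-⁅⁆ i j (trans (cong (λ s → lookup s i) (sym e)) (lookup-⁅⁆-self i))

  lookup-⊤ : ∀ {n} (i : Fin n) → lookup ⊤ i ≡ true
  lookup-⊤ Fin.zero    = refl
  lookup-⊤ (Fin.suc i) = lookup-⊤ i

  ⁅⁆≡⊤ : ∀ {n} {j : Fin n} → ⁅ j ⁆ ≡ ⊤ → ∀ i → i ≡ j
  ⁅⁆≡⊤ {j = j} e i = lookup-⁅⁆ i j (trans (cong (λ s → lookup s i) e) (lookup-⊤ i))

  ⁅⁆≢⊤ : ∀ {k} (j : Fin (suc (suc k))) → ⁅ j ⁆ ≢ ⊤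
  ⁅⁆≢⊤ j e with trans (⁅⁆≡⊤ e Fin.zero) (sym (⁅⁆≡⊤ e (Fin.suc Fin.zero)))
  ... | ()

  image-⁅⁆ : ∀ {q N} (f : Fin q → Fin N) (j : Fin q) → image f ⁅ j ⁆ ≡ ⁅ f j ⁆
  image-⁅⁆ {q} f j = vec-ext _ _ (λ k → trans (VecP.lookup∘tabulate _ k) (bool-ext (fw k) (bw k)))
    where
    fw : ∀ k → any (λ i → lookup ⁅ j ⁆ i ∧ (f i ==ᶠ k)) (allFin q) ≡ true → lookup ⁅ f j ⁆ k ≡ true
    fw k e with any-elim _ (allFin q) e
    ... | i , e′ with ∧-split {lookup ⁅ j ⁆ i} e′
    ... | e₁ , e₂ rewrite sym (==ᶠ-true {i = f i} e₂) | lookup-⁅⁆ i j e₁ = lookup-⁅⁆-self (f j)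
    bw : ∀ k → lookup ⁅ f j ⁆ k ≡ true → any (λ i → lookup ⁅ j ⁆ i ∧ (f i ==ᶠ k)) (allFin q) ≡ true
    bw k e = any-intro (MemP.∈-allFin j) (∧-intro (lookup-⁅⁆-self j) (==ᶠ-intro (sym (lookup-⁅⁆ k (f j) e))))

  tubing : ∀ n → Fin n → Fam n
  tubing n m t = (t ==ˢ ⊤) ∨ any (λ i → not (i ==ᶠ m) ∧ (t ==ˢ ⁅ i ⁆)) (allFin n)

  InTubing : ∀ {n} → Fin n → Subset n → Set
  InTubing {n} m t = (t ≡ ⊤) ⊎ (Σ[ i ∈ Fin n ] (i ≢ m × t ≡ ⁅ i ⁆))

  tubing⇒ : ∀ {n} (m : Fin n) t → tubing n m t ≡ true → InTubing m t
  tubing⇒ {n} m t e with ∨-split {t ==ˢ ⊤} e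
  ... | inj₁ e′ = inj₁ (==ˢ-true e′)
  ... | inj₂ e′ with any-elim _ (allFin n) e′
  ... | i , e″ with ∧-split {not (i ==ᶠ m)} e″
  ... | e₁ , e₂ = inj₂ (i , (λ im → true≢false (trans (sym (==ᶠ-intro im)) (not-true e₁))) , ==ˢ-true e₂)

  tubing⇐ : ∀ {n} (m : Fin n) t → InTubing m t → tubing n m t ≡ true
  tubing⇐ {n} m t (inj₁ refl) = ∨-introˡ _ (==ˢ-intro {s = ⊤ {n}} refl)
  tubing⇐ {n} m t (inj₂ (i , ne , refl)) =
    ∨-introʳ (t ==ˢ ⊤) (any-intro (MemP.∈-allFin i) (∧-intro (not-intro (==ᶠ-false ne)) (==ˢ-intro {s = ⁅ i ⁆} refl)))

  tubing-singleton : ∀ {n} (m i : Fin n) → i ≢ m → tubing n m ⁅ i ⁆ ≡ true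
  tubing-singleton m i ne = tubing⇐ m ⁅ i ⁆ (inj₂ (i , ne , refl))

  tubing-omits : ∀ {k} (m : Fin (suc (suc k))) → tubing (suc (suc k)) m ⁅ m ⁆ ≡ false
  tubing-omits m = BoolP.¬-not (λ e → omitted (tubing⇒ m ⁅ m ⁆ e))
    where
    omitted : InTubing m ⁅ m ⁆ → ⊥
    omitted (inj₁ e)           = ⁅⁆≢⊤ m e
    omitted (inj₂ (i , ne , e)) = ne (sym (⁅⁆-injective e))

  tubing-tubes : ∀ {n} (m : Fin n) t → tubing n m t ≡ true → IsTube t
  tubing-tubes m t e with tubing⇒ m t e
  ... | inj₁ t⊤            = inj₂ t⊤
  ... | inj₂ (i , _ , t⁅i⁆) = inj₁ (i , t⁅i⁆)

  card-sum : ∀ {n} (T : Fam n) → card T ≡ sumOver (λ t → indB (T t)) (allSubsets n)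
  card-sum {n} T = go (allSubsets n)
    where
    go : ∀ xs → length (filter (λ t → T t 𝔹.≟ true) xs) ≡ sumOver (λ t → indB (T t)) xs
    go [] = refl
    go (x ∷ xs) with T x
    ... | true  = cong suc (go xs)
    ... | false = go xs

  card-cong : ∀ {n} {G H : Fam n} → (∀ t → G t ≡ H t) → card G ≡ card H
  card-cong {n} {G} {H} e = trans (card-sum G) (trans (sumOver-cong (allSubsets n) (λ t → cong indB (e t))) (sym (card-sum H)))

  sumOver-mono : ∀ {X : Set} (f g : X → ℕ) xs → (∀ x → f x ≤ g x) → sumOver f xs ≤ sumOver g xs
  sumOver-mono f g []       le = z≤n
  sumOver-mono f g (x ∷ xs) le = ℕP.+-mono-≤ (le x) (sumOver-mono f g xs le)

  sumOver-≤-≡ : ∀ {X : Set} (f g : X → ℕ) xs → (∀ x → f x ≤ g x) → sumOver f xs ≡ sumOver g xs → ∀ {x} → x ∈ xs → f x ≡ g x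
  sumOver-≤-≡ f g (y ∷ ys) le e (here refl) =
    ℕP.≤-antisym (le y) (ℕP.+-cancelʳ-≤ (sumOver f ys) (g y) (f y)
      (ℕP.≤-trans (ℕP.+-monoʳ-≤ (g y) (sumOver-mono f g ys le)) (ℕP.≤-reflexive (sym e))))
  sumOver-≤-≡ f g (y ∷ ys) le e (there m) =
    sumOver-≤-≡ f g ys le (ℕP.+-cancelˡ-≡ (f y) _ _ (trans e (cong (_+ sumOver g ys) (sym (sumOver-≤-≡ f g (y ∷ ys) le e (here refl)))))) m

  count-others : ∀ n (m : Fin n) → suc (sumOver (λ i → indB (not (i ==ᶠ m))) (allFin n)) ≡ n
  count-others n m = begin
      suc (sumOver (λ i → indB (not (i ==ᶠ m))) (allFin n))
    ≡⟨ cong (_+ sumOver (λ i → indB (not (i ==ᶠ m))) (allFin n)) (sym (enumerates-allFin n m (λ _ → 1))) ⟩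
      sumOver (λ i → indB (i ==ᶠ m) * 1) (allFin n) + sumOver (λ i → indB (not (i ==ᶠ m))) (allFin n)
    ≡⟨ sym (sumOver-+ _ _ (allFin n)) ⟩
      sumOver (λ i → indB (i ==ᶠ m) * 1 + indB (not (i ==ᶠ m))) (allFin n)
    ≡⟨ sumOver-cong (allFin n) (λ i → one-of-two (i ==ᶠ m)) ⟩
      sumOver (λ _ → 1) (allFin n)
    ≡⟨ trans (length-sum (allFin n)) (ListP.length-tabulate id) ⟩
      n
    ∎
    where
    open ≡-Reasoning
    one-of-two : ∀ b → indB b * 1 + indB (not b) ≡ 1
    one-of-two true  = refl
    one-of-two false = refl
    length-sum : ∀ {X : Set} (xs : List X) → sumOver (λ _ → 1) xs ≡ length xs
    length-sum []       = refl
    length-sum (x ∷ xs) = cong suc (length-sum xs)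

  module _ {k : ℕ} where

    private
      N : ℕ
    N = suc (suc k)

    tube-count : ∀ t → IsTube t → indB (t ==ˢ ⊤) + sumOver (λ i → indB (t ==ˢ ⁅ i ⁆)) (allFin N) ≡ 1
    tube-count t (inj₂ refl) = cong₂ _+_ (ind-yes (VecP.≡-dec 𝔹._≟_ ⊤ ⊤) refl)
      (trans (sumOver-cong (allFin N) (λ i → ind-no (VecP.≡-dec 𝔹._≟_ ⊤ ⁅ i ⁆) (λ e → ⁅⁆≢⊤ i (sym e)))) (sumOver-0 (allFin N)))
    tube-count t (inj₁ (j , refl)) = cong₂ _+_ (ind-no (VecP.≡-dec 𝔹._≟_ ⁅ j ⁆ ⊤) (⁅⁆≢⊤ j))
      (trans (sumOver-cong (allFin N) (λ i → trans
               (ind-⇔ (VecP.≡-dec 𝔹._≟_ ⁅ j ⁆ ⁅ i ⁆) (i FinP.≟ j) (λ e → sym (⁅⁆-injective e)) (λ e → cong ⁅_⁆ (sym e)))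
               (sym (ℕP.*-identityʳ _))))
             (enumerates-allFin N j (λ _ → 1)))

    card-tubes : ∀ (G : Fam N) → (∀ t → G t ≡ true → IsTube t) → G ⊤ ≡ true →
                 card G ≡ suc (sumOver (λ i → indB (G ⁅ i ⁆)) (allFin N))
    card-tubes G tubes G⊤ = begin
        card G
      ≡⟨ card-sum G ⟩
        sumOver (λ t → indB (G t)) subsets
      ≡⟨ sumOver-cong subsets split ⟩
        sumOver (λ t → indB (t ==ˢ ⊤) * indB (G t) + sumOver (λ i → indB (t ==ˢ ⁅ i ⁆) * indB (G t)) (allFin N)) subsets
      ≡⟨ sumOver-+ _ _ subsets ⟩
        sumOver (λ t → indB (t ==ˢ ⊤) * indB (G t)) subsets
          + sumOver (λ t → sumOver (λ i → indB (t ==ˢ ⁅ i ⁆) * indB (G t)) (allFin N)) subsets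
      ≡⟨ cong₂ _+_ (trans (enumerates-allSubsets N ⊤ (λ t → indB (G t))) (cong indB G⊤))
                   (trans (sumOver-swap (λ t i → indB (t ==ˢ ⁅ i ⁆) * indB (G t)) subsets (allFin N))
                          (sumOver-cong (allFin N) (λ i → enumerates-allSubsets N ⁅ i ⁆ (λ t → indB (G t))))) ⟩
        suc (sumOver (λ i → indB (G ⁅ i ⁆)) (allFin N))
      ∎
      where
      open ≡-Reasoning
      subsets : List (Subset N)
      subsets = allSubsets N
      split : ∀ t → indB (G t) ≡ indB (t ==ˢ ⊤) * indB (G t) + sumOver (λ i → indB (t ==ˢ ⁅ i ⁆) * indB (G t)) (allFin N)
      split t with G t in e
      ... | false = sym (cong₂ _+_ (ℕP.*-zeroʳ (indB (t ==ˢ ⊤)))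
                          (trans (sumOver-cong (allFin N) (λ i → ℕP.*-zeroʳ (indB (t ==ˢ ⁅ i ⁆)))) (sumOver-0 (allFin N))))
      ... | true  = sym (trans (cong₂ _+_ (ℕP.*-identityʳ (indB (t ==ˢ ⊤))) (sumOver-cong (allFin N) (λ i → ℕP.*-identityʳ (indB (t ==ˢ ⁅ i ⁆)))))
                               (tube-count t (tubes t e)))

  tubing-isNTubing : ∀ n (m : Fin (suc n)) → IsNTubing (suc n) (tubing (suc n) m)
  tubing-isNTubing zero Fin.zero =
    ((λ t e → tubing-tubes Fin.zero t e) , tubing⇐ {1} Fin.zero ⊤ (inj₁ refl) , (λ { (s≤s ()) })) , refl
  tubing-isNTubing (suc k) m =
    ((λ t e → tubing-tubes m t e) , tubing⇐ m ⊤ (inj₁ refl) , (λ _ all → true≢false (trans (sym (all m)) (tubing-omits m)))) ,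
    trans (card-tubes (tubing N m) (λ t e → tubing-tubes m t e) (tubing⇐ m ⊤ (inj₁ refl)))
          (trans (cong suc (sumOver-cong (allFin N) singletons)) (count-others N m))
    where
    N : ℕ
    N = suc (suc k)
    singletons : ∀ i → indB (tubing N m ⁅ i ⁆) ≡ indB (not (i ==ᶠ m))
    singletons i with i FinP.≟ m
    ... | yes refl = cong indB (tubing-omits m)
    ... | no ne    = cong indB (tubing-singleton m i ne)

  isNTubing-cong : ∀ {n} {G H : Fam n} → (∀ t → G t ≡ H t) → IsNTubing n G → IsNTubing n H
  isNTubing-cong {n} e ((tubes , top , notAll) , c) =
    ((λ t h → tubes t (trans (e t) h)) , trans (sym (e ⊤)) top , (λ le all → notAll le (λ i → trans (e ⁅ i ⁆) (all i)))) ,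
    trans (sym (card-cong e)) c

  -- E_0 has no 0-tubing: the universal tube alone is already one tube
  no-0-tubing : ∀ (G : Fam 0) → ¬ IsNTubing 0 G
  no-0-tubing G ((_ , top , _) , c) with trans (sym (card-sum G)) c
  ... | e rewrite top = ℕP.1+n≢0 e

  indB≤1 : ∀ a → indB a ≤ 1
  indB≤1 true  = s≤s z≤n
  indB≤1 false = z≤n

  -- counting: an N-tubing omitting {m} has N - 1 singletons, so it
  -- contains all singletons other than {m}
  others-present : ∀ {k} (G : Fam (suc (suc k))) → IsNTubing (suc (suc k)) G →
                   ∀ m → G ⁅ m ⁆ ≡ false → ∀ i → i ≢ m → G ⁅ i ⁆ ≡ true
  others-present {k} G ((tubes , top , _) , c) m Gm i i≢m
    with G ⁅ i ⁆ | sumOver-≤-≡ _ _ (allFin N) bounded same-count (MemP.∈-allFin i)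
    where
    N : ℕ
    N = suc (suc k)
    same-count : sumOver (λ i → indB (G ⁅ i ⁆)) (allFin N) ≡ sumOver (λ i → indB (not (i ==ᶠ m))) (allFin N)
    same-count = ℕP.suc-injective (trans (sym (card-tubes G tubes top)) (trans c (sym (count-others N m))))
    bounded : ∀ i → indB (G ⁅ i ⁆) ≤ indB (not (i ==ᶠ m))
    bounded i with i FinP.≟ m
    ... | yes refl rewrite Gm = z≤n
    ... | no ne = indB≤1 _
  ... | true  | _ = refl
  ... | false | h = ⊥-elim (ℕP.0≢1+n (trans h (cong (λ b → indB (not b)) (==ᶠ-false i≢m))))

  classify-NTubing : ∀ n (G : Fam (suc n)) → IsNTubing (suc n) G → Σ[ m ∈ Fin (suc n) ] (∀ t → G t ≡ tubing (suc n) m t)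
  classify-NTubing zero G ((tubes , top , _) , _) = Fin.zero , λ t → bool-ext (fw t) (bw t)
    where
    fw : ∀ t → G t ≡ true → tubing 1 Fin.zero t ≡ true
    fw t e with tubes t e
    ... | inj₂ t⊤              = tubing⇐ Fin.zero t (inj₁ t⊤)
    ... | inj₁ (Fin.zero , t1) = tubing⇐ Fin.zero t (inj₁ t1)
    bw : ∀ t → tubing 1 Fin.zero t ≡ true → G t ≡ true
    bw t e with tubing⇒ Fin.zero t e
    ... | inj₁ refl                 = top
    ... | inj₂ (Fin.zero , ne , _) = ⊥-elim (ne refl)
  classify-NTubing (suc k) G nt@((tubes , top , notAll) , _) = m , λ t → bool-ext (fw t) (bw t)
    where
    N : ℕ
    N = suc (suc k)
    absent : ∃ λ i → ¬ (G ⁅ i ⁆ ≡ true)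
    absent = FinP.¬∀⟶∃¬ N (λ i → G ⁅ i ⁆ ≡ true) (λ i → G ⁅ i ⁆ 𝔹.≟ true) (notAll (s≤s (s≤s z≤n)))
    m : Fin N
    m = proj₁ absent
    Gm : G ⁅ m ⁆ ≡ false
    Gm = BoolP.¬-not (proj₂ absent)
    fw : ∀ t → G t ≡ true → tubing N m t ≡ true
    fw t e with tubes t e
    ... | inj₂ t⊤        = tubing⇐ m t (inj₁ t⊤)
    ... | inj₁ (i , refl) = tubing-singleton m i (λ im → true≢false (trans (sym e) (trans (cong (λ z → G ⁅ z ⁆) im) Gm)))
    bw : ∀ t → tubing N m t ≡ true → G t ≡ true
    bw t e with tubing⇒ m t e
    ... | inj₁ refl             = top
    ... | inj₂ (i , ne , refl) = others-present G nt m Gm i ne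

  ↑ˡ≢↑ʳ : ∀ {p q} (i : Fin p) (j : Fin q) → i ↑ˡ q ≢ p ↑ʳ j
  ↑ˡ≢↑ʳ {p} {q} i j e with trans (sym (FinP.splitAt-↑ˡ p i q)) (trans (cong (splitAt p) e) (FinP.splitAt-↑ʳ p q j))
  ... | ()

  -- w_ι for v = tubing q m is the tubing missing ι̂(m): its singletons are
  -- the images of the first block and of the second block except m
  module _ {p q : ℕ} (G : Fam p) (H : Fam q) (m : Fin q) (ι : Vec (Fin (p + q)) (p + q))
           (H≡tubing : ∀ t → H t ≡ tubing q m t) (sh : IsShuffle p q ι) where

    private
      injective : ∀ a b → lookup ι a ≡ lookup ι b → a ≡ b
      injective = proj₁ sh
      surjective : ∀ k → ∃ λ a → lookup ι a ≡ k
      surjective = proj₁ (proj₂ sh)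
      ι̂ : Fin q → Fin (p + q)
      ι̂ j = lookup ι (p ↑ʳ j)
      firstBlock : Subset (p + q) → Bool
      firstBlock t = any (λ i → t ==ˢ ⁅ lookup ι (i ↑ˡ q) ⁆) (allFin p)
      secondBlock : Subset (p + q) → Bool
      secondBlock t = any (λ t′ → H t′ ∧ not (t′ ==ˢ ⊤) ∧ (t ==ˢ image ι̂ t′)) (allSubsets q)

      w⇒tubing : ∀ t → w G H ι t ≡ true → tubing (p + q) (ι̂ m) t ≡ true
      w⇒tubing t e with ∨-split {firstBlock t} e
      ... | inj₁ e₁ with any-elim _ (allFin p) e₁
      ... | i , e₂ = tubing⇐ (ι̂ m) t (inj₂ (lookup ι (i ↑ˡ q) , (λ eq → ↑ˡ≢↑ʳ i m (injective _ _ eq)) , ==ˢ-true e₂))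
      w⇒tubing t e | inj₂ e₁ with ∨-split {secondBlock t} e₁
      ... | inj₂ e₂ = tubing⇐ (ι̂ m) t (inj₁ (==ˢ-true e₂))
      ... | inj₁ e₂ with any-elim _ (allSubsets q) e₂
      ... | t′ , e₃ with ∧-split {H t′} e₃
      ... | h₁ , h₂ with ∧-split {not (t′ ==ˢ ⊤)} h₂
      ... | h₃ , h₄ with tubing⇒ m t′ (trans (sym (H≡tubing t′)) h₁)
      ... | inj₁ t′⊤ = ⊥-elim (true≢false (trans (sym (==ˢ-intro t′⊤)) (not-true h₃)))
      ... | inj₂ (j , ne , refl) =
            tubing⇐ (ι̂ m) t (inj₂ (ι̂ j , (λ eq → ne (FinP.↑ʳ-injective p j m (injective _ _ eq))) , trans (==ˢ-true h₄) (image-⁅⁆ ι̂ j)))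

      tubing⇒w : ∀ t → tubing (p + q) (ι̂ m) t ≡ true → w G H ι t ≡ true
      tubing⇒w t e with tubing⇒ (ι̂ m) t e
      ... | inj₁ refl = ∨-introʳ (firstBlock ⊤) (∨-introʳ (secondBlock ⊤) (==ˢ-intro {s = ⊤ {p + q}} refl))
      ... | inj₂ (k , ne , refl) with splitView p q (proj₁ (surjective k))
      ... | inj₁ (i , ei) =
            ∨-introˡ _ (any-intro (MemP.∈-allFin i) (==ˢ-intro (cong ⁅_⁆ (sym (trans (cong (lookup ι) (sym ei)) (proj₂ (surjective k)))))))
      ... | inj₂ (j , ej) = ∨-introʳ (firstBlock ⁅ k ⁆) (∨-introˡ _
            (any-intro (∈-allSubsets q ⁅ j ⁆) (∧-intro (trans (H≡tubing ⁅ j ⁆) (tubing-singleton m j j≢m))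
               (∧-intro (not-intro (BoolP.¬-not (λ e′ → j≢m (sym (⁅⁆≡⊤ (==ˢ-true e′) m)))))
                        (==ˢ-intro (trans (cong ⁅_⁆ (sym ι̂j≡k)) (sym (image-⁅⁆ ι̂ j))))))))
        where
        ι̂j≡k : ι̂ j ≡ k
        ι̂j≡k = trans (cong (lookup ι) (sym ej)) (proj₂ (surjective k))
        j≢m : j ≢ m
        j≢m e′ = ne (trans (sym ι̂j≡k) (cong ι̂ e′))

    w≡tubing : ∀ t → w G H ι t ≡ tubing (p + q) (lookup ι (p ↑ʳ m)) t
    w≡tubing t = bool-ext (w⇒tubing t) (tubing⇒w t)

  -- the missing node of a tubing, read off as the first absent singleton
  firstFalse : ∀ n → (Fin (suc n) → Bool) → ℕ
  firstFalse zero    f = 0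
  firstFalse (suc n) f = if f Fin.zero then suc (firstFalse n (λ i → f (Fin.suc i))) else 0

  firstFalse-cong : ∀ n {f g : Fin (suc n) → Bool} → (∀ i → f i ≡ g i) → firstFalse n f ≡ firstFalse n g
  firstFalse-cong zero    e = refl
  firstFalse-cong (suc n) {f} {g} e
    rewrite e Fin.zero | firstFalse-cong n {λ i → f (Fin.suc i)} {λ i → g (Fin.suc i)} (λ i → e (Fin.suc i)) = refl

  firstFalse-value : ∀ n (f : Fin (suc n) → Bool) (m : Fin (suc n)) →
                     (∀ i → toℕ i < toℕ m → f i ≡ true) → (f m ≡ false ⊎ toℕ m ≡ n) → firstFalse n f ≡ toℕ m
  firstFalse-value zero    f Fin.zero    before stop = refl
  firstFalse-value (suc n) f Fin.zero    before (inj₁ e) rewrite e = refl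
  firstFalse-value (suc n) f (Fin.suc m) before stop rewrite before Fin.zero (s≤s z≤n) =
    cong suc (firstFalse-value n (λ i → f (Fin.suc i)) m (λ i lt → before (Fin.suc i) (s≤s lt)) (stop′ stop))
    where
    stop′ : f (Fin.suc m) ≡ false ⊎ suc (toℕ m) ≡ suc n → f (Fin.suc m) ≡ false ⊎ toℕ m ≡ n
    stop′ (inj₁ e) = inj₁ e
    stop′ (inj₂ e) = inj₂ (ℕP.suc-injective e)

  missing : ∀ n → Fam n → ℕ
  missing zero    G = 0
  missing (suc n) G = firstFalse n (λ i → G ⁅ i ⁆)

  missing-cong : ∀ n {G H : Fam n} → (∀ t → G t ≡ H t) → missing n G ≡ missing n H
  missing-cong zero    e = refl
  missing-cong (suc n) e = firstFalse-cong n (λ i → e ⁅ i ⁆)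

  missing-tubing : ∀ n (m : Fin (suc n)) → missing (suc n) (tubing (suc n) m) ≡ toℕ m
  missing-tubing zero    Fin.zero = refl
  missing-tubing (suc k) m =
    firstFalse-value (suc k) _ m (λ i lt → tubing-singleton m i (λ e → ℕP.<-irrefl (cong toℕ e) lt)) (inj₁ (tubing-omits m))

-- By the classification of n-tubings, a
-- basis element of ΔSym is determined by its key (degree, missing node);
-- the unit has key (0, 0).  A formal sum x acts on functions
-- φ : RawBasis → ℚ by eval x φ = Σ aₖ φ(rₖ); coefficients are evaluations
-- at Kronecker deltas, and on well-formed sums these deltas only depend on
-- keys.  The central fact is vanishing-keys: if every key-coefficient of
-- a formal sum z vanishes (where it is weighted by ψ), then z evaluates to
-- 0 against any function of the keys; so sums that are equal in ΔSym have
-- the same key-evaluations.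
module Keys where

  open import Data.Nat using (_≤_; _<_)
  open import Data.Bool.ListAction using (all)
  open import Data.Unit using (⊤; tt)
  import Data.Product.Properties as ×P
  open import Data.List.Membership.Propositional using (_∈_)
  import Data.List.Membership.Propositional.Properties as MemP
  open import Data.List.Relation.Unary.Any using (here)
  import Data.List.Relation.Unary.All.Properties as AllP
  open import Data.Rational.Solver using (module +-*-Solver)
  open +-*-Solver using (solve; _:+_; _:*_; _:=_; con)
  open ℚΣ
  open Tubings
  import Data.Bool.Properties as BoolP

  Key : Set
  Key = ℕ × ℕ

  infix 4 _≟K_
  _≟K_ : DecidableEquality Key
  _≟K_ = ×P.≡-dec ℕ._≟_ ℕ._≟_

  indK : Key → Key → ℚ
  indK k k′ = ind (k ≟K k′)

  degK : Key → ℕ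
  degK = proj₁

  keyR : RawBasis → Key
  keyR one     = 0 , 0
  keyR (F n G) = n , missing n G

  keyB : Basis → Key
  keyB one           = 0 , 0
  keyB (F n (T , _)) = n , missing n T

  bas : (r : RawBasis) → Proper r → Basis
  bas one     _  = one
  bas (F n G) pr = F n (G , pr)

  keyB-bas : ∀ r pr → keyB (bas r pr) ≡ keyR r
  keyB-bas one     _ = refl
  keyB-bas (F n G) _ = refl

  deg-keyB : ∀ b → deg b ≡ degK (keyB b)
  deg-keyB one     = refl
  deg-keyB (F n _) = refl

  nTubing-positive : ∀ n (G : Fam n) → IsNTubing n G → Σ[ n′ ∈ ℕ ] n ≡ suc n′
  nTubing-positive zero    G nt = ⊥-elim (no-0-tubing G nt)
  nTubing-positive (suc n) G nt = n , refl

  missing-classify : ∀ n (G : Fam (suc n)) (nt : IsNTubing (suc n) G) → missing (suc n) G ≡ toℕ (proj₁ (classify-NTubing n G nt))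
  missing-classify n G nt = trans (missing-cong (suc n) (proj₂ (classify-NTubing n G nt))) (missing-tubing n _)

  ValidKey : Key → Set
  ValidKey (zero  , m) = ⊤
  ValidKey (suc n , m) = m < suc n

  keyR-valid : ∀ r → Proper r → ValidKey (keyR r)
  keyR-valid one     _  = tt
  keyR-valid (F n G) pG with nTubing-positive n G pG
  ... | n′ , refl = subst (_< suc n′) (sym (missing-classify n′ G pG)) (FinP.toℕ<n _)

  sameKey⇒equal : ∀ n (G T : Fam n) → IsNTubing n G → IsNTubing n T → missing n G ≡ missing n T → ∀ t → G t ≡ T t
  sameKey⇒equal n G T pG pT e with nTubing-positive n G pG
  ... | n′ , refl with classify-NTubing n′ G pG | classify-NTubing n′ T pT | missing-classify n′ G pG | missing-classify n′ T pT
  ... | a , G≡a | b , T≡b | ka | kb = λ t → trans (G≡a t) (trans (cong (λ z → tubing (suc n′) z t) a≡b) (sym (T≡b t)))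
    where
    a≡b : a ≡ b
    a≡b = FinP.toℕ-injective (trans (sym ka) (trans e kb))

  private
    ⌊⌋-true : ∀ {a b : Bool} → ⌊ a 𝔹.≟ b ⌋ ≡ true → a ≡ b
    ⌊⌋-true {a} {b} e with a 𝔹.≟ b
    ... | yes p = p

    ⌊⌋-intro : ∀ {a b : Bool} → a ≡ b → ⌊ a 𝔹.≟ b ⌋ ≡ true
    ⌊⌋-intro {a} {b} e with a 𝔹.≟ b
    ... | yes _ = refl
    ... | no ¬p = ⊥-elim (¬p e)

  matches⇒sameKey : ∀ r b → matches r b ≡ true → keyR r ≡ keyB b
  matches⇒sameKey one     one           _  = refl
  matches⇒sameKey one     (F _ _)       ()
  matches⇒sameKey (F _ _) one           ()
  matches⇒sameKey (F m G) (F n (T , _)) e with m ℕ.≟ n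
  matches⇒sameKey (F m G) (F .m (T , _)) e | yes refl =
    cong (m ,_) (missing-cong m (λ t → ⌊⌋-true (all-elim _ (allSubsets m) e (∈-allSubsets m t))))

  sameKey⇒matches : ∀ r → Proper r → ∀ b → keyR r ≡ keyB b → matches r b ≡ true
  sameKey⇒matches one     _  one           _ = refl
  sameKey⇒matches one     _  (F n (T , pT)) e = ⊥-elim (ℕP.0≢1+n (trans (cong proj₁ e) (proj₂ (nTubing-positive n T pT))))
  sameKey⇒matches (F m G) pG one           e = ⊥-elim (ℕP.0≢1+n (trans (sym (cong proj₁ e)) (proj₂ (nTubing-positive m G pG))))
  sameKey⇒matches (F m G) pG (F n (T , pT)) e with m ℕ.≟ n
  ... | no m≢n = ⊥-elim (m≢n (cong proj₁ e))
  ... | yes refl =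
    all-intro _ (allSubsets m) (λ t → ⌊⌋-intro (sameKey⇒equal m G T pG pT (cong proj₂ e) t))

  matches-key : ∀ r → Proper r → ∀ b → matches r b ≡ ⌊ keyR r ≟K keyB b ⌋
  matches-key r pr b with keyR r ≟K keyB b
  ... | yes e = sameKey⇒matches r pr b e
  ... | no ne = BoolP.¬-not (λ e → ne (matches⇒sameKey r b e))

  eval : Formal → (RawBasis → ℚ) → ℚ
  eval x φ = sumOver (λ e → proj₁ e ℚ.* φ (proj₂ e)) x

  δ : Basis → RawBasis → ℚ
  δ b r = indB (matches r b)

  coeff-eval : ∀ x b → coeff x b ≡ eval x (δ b)
  coeff-eval []            b = refl
  coeff-eval ((a , r) ∷ x) b = cong₂ ℚ._+_ (scale (matches r b)) (coeff-eval x b)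
    where
    scale : ∀ c → (if c then a else 0ℚ) ≡ a ℚ.* indB c
    scale true  = sym (ℚP.*-identityʳ a)
    scale false = sym (ℚP.*-zeroʳ a)

  ≈-by-eval : ∀ x y → (∀ φ → eval x φ ≡ eval y φ) → x ≈ y
  ≈-by-eval x y e b = trans (coeff-eval x b) (trans (e (δ b)) (sym (coeff-eval y b)))

  eval-⊕ : ∀ x y φ → eval (x ⊕ y) φ ≡ eval x φ ℚ.+ eval y φ
  eval-⊕ x y φ = sumOver-++ _ x y

  eval-⊙ : ∀ c x φ → eval (c ⊙ x) φ ≡ c ℚ.* eval x φ
  eval-⊙ c x φ = trans (sumOver-map _ _ x) (trans (sumOver-cong x (λ e → ℚP.*-assoc c (proj₁ e) _)) (sumOver-* c _ x))

  eval-cong : ∀ x {φ φ′ : RawBasis → ℚ} → (∀ r → φ r ≡ φ′ r) → eval x φ ≡ eval x φ′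
  eval-cong x e = sumOver-cong x (λ e′ → cong (proj₁ e′ ℚ.*_) (e (proj₂ e′)))

  eval-congWF : ∀ x → WF x → ∀ {φ φ′ : RawBasis → ℚ} → (∀ r → Proper r → φ r ≡ φ′ r) → eval x φ ≡ eval x φ′
  eval-congWF x wf e = sumOver-congAll (All.map (λ {e′} pr → cong (proj₁ e′ ℚ.*_) (e (proj₂ e′) pr)) wf)

  eval-+ : ∀ x (φ φ′ : RawBasis → ℚ) → eval x (λ r → φ r ℚ.+ φ′ r) ≡ eval x φ ℚ.+ eval x φ′
  eval-+ x φ φ′ = trans (sumOver-cong x (λ e → ℚP.*-distribˡ-+ (proj₁ e) _ _)) (sumOver-+ _ _ x)

  eval-* : ∀ x c (φ : RawBasis → ℚ) → eval x (λ r → c ℚ.* φ r) ≡ c ℚ.* eval x φ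
  eval-* x c φ = trans (sumOver-cong x (λ e → swap-scalars (proj₁ e) c (φ (proj₂ e)))) (sumOver-* c _ x)
    where
    swap-scalars : ∀ a c f → a ℚ.* (c ℚ.* f) ≡ c ℚ.* (a ℚ.* f)
    swap-scalars = solve 3 (λ a c f → a :* (c :* f) := c :* (a :* f)) refl

  eval-0 : ∀ x → eval x (λ _ → 0ℚ) ≡ 0ℚ
  eval-0 x = trans (sumOver-cong x (λ e → ℚP.*-zeroʳ (proj₁ e))) (sumOver-0 x)

  eval-single : ∀ r φ → eval ((1ℚ , r) ∷ []) φ ≡ φ r
  eval-single r φ = trans (ℚP.+-identityʳ _) (ℚP.*-identityˡ _)

  eval-· : ∀ x y φ → eval (x · y) φ ≡ eval x (λ r → eval y (λ r′ → eval (mulB r r′) φ))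
  eval-· x y φ = trans (sumOver-concatMap _ _ x) (sumOver-cong x term)
    where
    term : ∀ e → eval (concatMap (λ e′ → (proj₁ e ℚ.* proj₁ e′) ⊙ mulB (proj₂ e) (proj₂ e′)) y) φ
                 ≡ proj₁ e ℚ.* eval y (λ r′ → eval (mulB (proj₂ e) r′) φ)
    term (a , r) = trans (sumOver-concatMap _ _ y)
      (trans (sumOver-cong y (λ e′ → trans (eval-⊙ (a ℚ.* proj₁ e′) (mulB r (proj₂ e′)) φ) (ℚP.*-assoc a (proj₁ e′) _)))
             (sumOver-* a _ y))

  δ-key : ∀ r → Proper r → ∀ b → δ b r ≡ indK (keyR r) (keyB b)
  δ-key r pr b = cong indB (matches-key r pr b)

  keyCoeff : Formal → Key → ℚ
  keyCoeff x k = eval x (λ r → indK (keyR r) k)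

  coeff-keyCoeff : ∀ x → WF x → ∀ b → coeff x b ≡ keyCoeff x (keyB b)
  coeff-keyCoeff x wf b = trans (coeff-eval x b) (eval-congWF x wf (λ r pr → δ-key r pr b))

  keyCoeff-coeff : ∀ x → WF x → ∀ r pr → keyCoeff x (keyR r) ≡ coeff x (bas r pr)
  keyCoeff-coeff x wf r pr = trans (cong (keyCoeff x) (sym (keyB-bas r pr))) (sym (coeff-keyCoeff x wf (bas r pr)))

  private
    Other : Key → ℚ × RawBasis → Set
    Other k₀ e = ¬ (keyR (proj₂ e) ≡ k₀)

    other? : ∀ k₀ → Decidable (Other k₀)
    other? k₀ e = Relation.Nullary.¬? (keyR (proj₂ e) ≟K k₀)

    eval-separate : ∀ z k₀ (ψ : Key → ℚ) →
      eval z (λ r → ψ (keyR r)) ≡ ψ k₀ ℚ.* keyCoeff z k₀ ℚ.+ eval (filter (other? k₀) z) (λ r → ψ (keyR r))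
    eval-separate z k₀ ψ = begin
        eval z (λ r → ψ (keyR r))
      ≡⟨ sumOver-cong z split ⟩
        sumOver (λ e → proj₁ e ℚ.* (ψ k₀ ℚ.* indK (keyR (proj₂ e)) k₀) ℚ.+ ind (other? k₀ e) ℚ.* (proj₁ e ℚ.* ψ (keyR (proj₂ e)))) z
      ≡⟨ sumOver-+ _ _ z ⟩
        eval z (λ r → ψ k₀ ℚ.* indK (keyR r) k₀) ℚ.+ sumOver (λ e → ind (other? k₀ e) ℚ.* (proj₁ e ℚ.* ψ (keyR (proj₂ e)))) z
      ≡⟨ cong₂ ℚ._+_ (eval-* z (ψ k₀) (λ r → indK (keyR r) k₀)) (sym (sumOver-filter (other? k₀) _ z)) ⟩
        ψ k₀ ℚ.* keyCoeff z k₀ ℚ.+ eval (filter (other? k₀) z) (λ r → ψ (keyR r))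
      ∎
      where
      open ≡-Reasoning
      split : ∀ e → proj₁ e ℚ.* ψ (keyR (proj₂ e))
                    ≡ proj₁ e ℚ.* (ψ k₀ ℚ.* indK (keyR (proj₂ e)) k₀) ℚ.+ ind (other? k₀ e) ℚ.* (proj₁ e ℚ.* ψ (keyR (proj₂ e)))
      split (a , r) with keyR r ≟K k₀
      ... | yes refl = solve 2 (λ a ψ → a :* ψ := a :* (ψ :* con 1ℚ) :+ con 0ℚ :* (a :* ψ)) refl a (ψ (keyR r))
      ... | no _     = solve 3 (λ a ψ ψ₀ → a :* ψ := a :* (ψ₀ :* con 0ℚ) :+ con 1ℚ :* (a :* ψ)) refl a (ψ (keyR r)) (ψ k₀)

    keyCoeff-filter : ∀ z k₀ k → k ≢ k₀ → keyCoeff (filter (other? k₀) z) k ≡ keyCoeff z k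
    keyCoeff-filter z k₀ k k≢k₀ = trans (sumOver-filter (other? k₀) _ z) (sumOver-cong z keep)
      where
      keep : ∀ e → ind (other? k₀ e) ℚ.* (proj₁ e ℚ.* indK (keyR (proj₂ e)) k) ≡ proj₁ e ℚ.* indK (keyR (proj₂ e)) k
      keep (a , r) with keyR r ≟K k
      ... | yes refl = trans (cong (ℚ._* (a ℚ.* 1ℚ)) (ind-yes (other? k₀ (a , r)) k≢k₀)) (ℚP.*-identityˡ _)
      ... | no _     = trans (cong (ind (other? k₀ (a , r)) ℚ.*_) (ℚP.*-zeroʳ a)) (trans (ℚP.*-zeroʳ (ind (other? k₀ (a , r)))) (sym (ℚP.*-zeroʳ a)))

  filter-drops : ∀ {X : Set} {P : X → Set} (P? : Decidable P) x xs → ¬ P x → length (filter P? (x ∷ xs)) ≤ length xs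
  filter-drops P? x xs ¬px with P? x
  ... | yes px = ⊥-elim (¬px px)
  ... | no _   = ListP.length-filter P? xs

  vanishing-keys : ∀ z (ψ : Key → ℚ) →
    (∀ {e} → e ∈ z → ψ (keyR (proj₂ e)) ℚ.* keyCoeff z (keyR (proj₂ e)) ≡ 0ℚ) → eval z (λ r → ψ (keyR r)) ≡ 0ℚ
  vanishing-keys z = go (length z) z ℕP.≤-refl
    where
    go : ∀ n z → length z ≤ n → (ψ : Key → ℚ) →
         (∀ {e} → e ∈ z → ψ (keyR (proj₂ e)) ℚ.* keyCoeff z (keyR (proj₂ e)) ≡ 0ℚ) → eval z (λ r → ψ (keyR r)) ≡ 0ℚ
    go n       []         _  ψ h = refl
    go (suc n) (e₀ ∷ z₀) le ψ h = begin
        eval (e₀ ∷ z₀) (λ r → ψ (keyR r))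
      ≡⟨ eval-separate (e₀ ∷ z₀) k₀ ψ ⟩
        ψ k₀ ℚ.* keyCoeff (e₀ ∷ z₀) k₀ ℚ.+ eval rest (λ r → ψ (keyR r))
      ≡⟨ cong₂ ℚ._+_ (h (here refl)) (go n rest shorter ψ h′) ⟩
        0ℚ ℚ.+ 0ℚ
      ≡⟨ ℚP.+-identityʳ 0ℚ ⟩
        0ℚ
      ∎
      where
      open ≡-Reasoning
      k₀ : Key
      k₀ = keyR (proj₂ e₀)
      rest : Formal
      rest = filter (other? k₀) (e₀ ∷ z₀)
      shorter : length rest ≤ n
      shorter = ℕP.≤-trans (filter-drops (other? k₀) e₀ z₀ (λ other → other refl)) (ℕP.≤-pred le)
      h′ : ∀ {e} → e ∈ rest → ψ (keyR (proj₂ e)) ℚ.* keyCoeff rest (keyR (proj₂ e)) ≡ 0ℚ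
      h′ m with MemP.∈-filter⁻ (other? k₀) {xs = e₀ ∷ z₀} m
      ... | m′ , other = trans (cong (ψ _ ℚ.*_) (keyCoeff-filter (e₀ ∷ z₀) k₀ _ other)) (h m′)

  private
    difference-zero : ∀ a b → a ℚ.+ (ℚ.- 1ℚ) ℚ.* b ≡ 0ℚ → a ≡ b
    difference-zero a b e = trans (solve 2 (λ a b → a := (a :+ (con (ℚ.- 1ℚ) :* b)) :+ b) refl a b) (trans (cong (ℚ._+ b) e) (ℚP.+-identityˡ b))

  ≈⇒eval-keys : ∀ x x′ → WF x → WF x′ → x ≈ x′ → (ψ : Key → ℚ) → eval x (λ r → ψ (keyR r)) ≡ eval x′ (λ r → ψ (keyR r))
  ≈⇒eval-keys x x′ wf wf′ eq ψ = difference-zero _ _ (begin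
      eval x (λ r → ψ (keyR r)) ℚ.+ (ℚ.- 1ℚ) ℚ.* eval x′ (λ r → ψ (keyR r))
    ≡⟨ sym (trans (eval-⊕ x _ _) (cong (eval x (λ r → ψ (keyR r)) ℚ.+_) (eval-⊙ (ℚ.- 1ℚ) x′ _))) ⟩
      eval z (λ r → ψ (keyR r))
    ≡⟨ vanishing-keys z ψ (λ {e} m → trans (cong (ψ (keyR (proj₂ e)) ℚ.*_) (no-coeff m)) (ℚP.*-zeroʳ (ψ (keyR (proj₂ e))))) ⟩
      0ℚ
    ∎)
    where
    open ≡-Reasoning
    z = x ⊕ ((ℚ.- 1ℚ) ⊙ x′)
    wfz : WF z
    wfz = AllP.++⁺ wf (AllP.map⁺ wf′)
    no-coeff : ∀ {e} → e ∈ z → keyCoeff z (keyR (proj₂ e)) ≡ 0ℚ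
    no-coeff {a , r} m = begin
        keyCoeff z (keyR r)
      ≡⟨ trans (eval-⊕ x _ _) (cong₂ ℚ._+_ (keyCoeff-coeff x wf r pr) (trans (eval-⊙ (ℚ.- 1ℚ) x′ _) (cong ((ℚ.- 1ℚ) ℚ.*_) (keyCoeff-coeff x′ wf′ r pr)))) ⟩
        coeff x (bas r pr) ℚ.+ (ℚ.- 1ℚ) ℚ.* coeff x′ (bas r pr)
      ≡⟨ cong (λ c → c ℚ.+ (ℚ.- 1ℚ) ℚ.* coeff x′ (bas r pr)) (eq (bas r pr)) ⟩
        coeff x′ (bas r pr) ℚ.+ (ℚ.- 1ℚ) ℚ.* coeff x′ (bas r pr)
      ≡⟨ solve 1 (λ c → c :+ (con (ℚ.- 1ℚ) :* c) := con 0ℚ) refl (coeff x′ (bas r pr)) ⟩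
        0ℚ
      ∎
      where
      pr : Proper r
      pr = All.lookup wfz m

  indN : ℕ → ℕ → ℚ
  indN n p = ind (n ℕ.≟ p)

  homogeneous-eval : ∀ p x → WF x → Homog p x → (ψ : Key → ℚ) →
    eval x (λ r → ψ (keyR r)) ≡ eval x (λ r → indN (degK (keyR r)) p ℚ.* ψ (keyR r))
  homogeneous-eval p x wf hx ψ = begin
      eval x (λ r → ψ (keyR r))
    ≡⟨ eval-cong x split ⟩
      eval x (λ r → indN (degK (keyR r)) p ℚ.* ψ (keyR r) ℚ.+ ψ′ (keyR r))
    ≡⟨ eval-+ x (λ r → indN (degK (keyR r)) p ℚ.* ψ (keyR r)) (λ r → ψ′ (keyR r)) ⟩
      eval x (λ r → indN (degK (keyR r)) p ℚ.* ψ (keyR r)) ℚ.+ eval x (λ r → ψ′ (keyR r))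
    ≡⟨ cong (eval x (λ r → indN (degK (keyR r)) p ℚ.* ψ (keyR r)) ℚ.+_) (vanishing-keys x ψ′ other-degrees) ⟩
      eval x (λ r → indN (degK (keyR r)) p ℚ.* ψ (keyR r)) ℚ.+ 0ℚ
    ≡⟨ ℚP.+-identityʳ _ ⟩
      eval x (λ r → indN (degK (keyR r)) p ℚ.* ψ (keyR r))
    ∎
    where
    open ≡-Reasoning
    ψ′ : Key → ℚ
    ψ′ k = ind (Relation.Nullary.¬? (degK k ℕ.≟ p)) ℚ.* ψ k
    split : ∀ r → ψ (keyR r) ≡ indN (degK (keyR r)) p ℚ.* ψ (keyR r) ℚ.+ ψ′ (keyR r)
    split r with degK (keyR r) ℕ.≟ p
    ... | yes _ = sym (trans (cong₂ ℚ._+_ (ℚP.*-identityˡ (ψ (keyR r))) (ℚP.*-zeroˡ (ψ (keyR r)))) (ℚP.+-identityʳ _))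
    ... | no _  = sym (trans (cong₂ ℚ._+_ (ℚP.*-zeroˡ (ψ (keyR r))) (ℚP.*-identityˡ (ψ (keyR r)))) (ℚP.+-identityˡ _))
    other-degrees : ∀ {e} → e ∈ x → ψ′ (keyR (proj₂ e)) ℚ.* keyCoeff x (keyR (proj₂ e)) ≡ 0ℚ
    other-degrees {a , r} m with degK (keyR r) ℕ.≟ p
    ... | yes _ = trans (cong (ℚ._* keyCoeff x (keyR r)) (ℚP.*-zeroˡ (ψ (keyR r)))) (ℚP.*-zeroˡ (keyCoeff x (keyR r)))
    ... | no d≢p = trans (cong ((1ℚ ℚ.* ψ (keyR r)) ℚ.*_) (trans (keyCoeff-coeff x wf r pr) (hx (bas r pr) deg≢p))) (ℚP.*-zeroʳ (1ℚ ℚ.* ψ (keyR r)))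
      where
      pr : Proper r
      pr = All.lookup wf m
      deg≢p : deg (bas r pr) ≢ p
      deg≢p e = d≢p (trans (sym (trans (deg-keyB (bas r pr)) (cong degK (keyB-bas r pr)))) e)

-- By w_ι = tubing (p+q) (ι̂ m)
-- and the correspondence between shuffles and words, the product of the
-- basis elements with keys (p, a) and (q, b) is the sum over the words σ
-- of shape (p, q) of the basis elements with key (p + q, pos false σ b);
-- the key 0 is a two-sided unit.  Every axiom is then checked on
-- evaluations: associativity reduces to the reindexing identity
-- pos-sum-assoc, compatibility with ≈ to ≈⇒eval-keys, gradedness to
-- homogeneous-eval.
module Product where

  open import Data.Nat using (_+_)

  import Data.List.Relation.Unary.All.Properties as AllP
  open ℚΣ
  open Words using (pos)
  open WordSums using (sumWords; sumWords-cong; sumWords-congShape; sumWords-*; sumWords-sumOver; sumWords-0; pos-sum-assoc)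
  open Shuffles using (sumOver-shuffles; shuffleOf-right; shuffleOf)
  open Tubings using (tubing; classify-NTubing; w≡tubing; tubing-isNTubing; isNTubing-cong; no-0-tubing; missing-cong; missing-tubing)
  open Keys

  -- Σ Ψ over the product of the basis elements with keys k and k′
  mulKey : Key → Key → (Key → ℚ) → ℚ
  mulKey (zero  , _) k           Ψ = Ψ k
  mulKey (suc p , a) (zero , _)  Ψ = Ψ (suc p , a)
  mulKey (suc p , a) (suc q , b) Ψ = sumWords (suc p) (suc q) (λ σ → Ψ (suc p + suc q , pos false σ b))

  mulKey-eval : ∀ k k′ (z : Formal) (f : Key → RawBasis → ℚ) →
                mulKey k k′ (λ k″ → eval z (f k″)) ≡ eval z (λ r → mulKey k k′ (λ k″ → f k″ r))
  mulKey-eval (zero  , _) k′          z f = refl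
  mulKey-eval (suc p , a) (zero , _)  z f = refl
  mulKey-eval (suc p , a) (suc q , b) z f =
    trans (sumWords-sumOver (suc p) (suc q) (λ σ e → proj₁ e ℚ.* f (suc p + suc q , pos false σ b) (proj₂ e)) z)
          (sumOver-cong z (λ e → sumWords-* (suc p) (suc q) (proj₁ e) (λ σ → f (suc p + suc q , pos false σ b) (proj₂ e))))

  mulKey-degree : ∀ k k′ (Ψ : Key → ℚ) → (∀ k″ → degK k″ ≡ degK k + degK k′ → Ψ k″ ≡ 0ℚ) → mulKey k k′ Ψ ≡ 0ℚ
  mulKey-degree (zero  , _) k′          Ψ h = h k′ refl
  mulKey-degree (suc p , a) (zero , _)  Ψ h = h (suc p , a) (sym (ℕP.+-identityʳ (suc p)))
  mulKey-degree (suc p , a) (suc q , b) Ψ h = trans (sumWords-cong (suc p) (suc q) (λ σ → h (suc p + suc q , pos false σ b) refl)) (sumWords-0 (suc p) (suc q))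

  mulKey-assoc : ∀ k k′ k″ (Ψ : Key → ℚ) → ValidKey k″ →
                 mulKey k k′ (λ l → mulKey l k″ Ψ) ≡ mulKey k′ k″ (λ l → mulKey k l Ψ)
  mulKey-assoc (zero  , _) k′          k″          Ψ v = refl
  mulKey-assoc (suc p , a) (zero , _)  k″          Ψ v = refl
  mulKey-assoc (suc p , a) (suc q , b) (zero , _)  Ψ v = refl
  mulKey-assoc (suc p , a) (suc q , b) (suc r , c) Ψ v =
    trans (pos-sum-assoc (suc p) (suc q) (suc r) c (λ n → Ψ (suc p + suc q + suc r , n)) v)
          (sumWords-cong (suc q) (suc r) (λ τ → sumWords-cong (suc p) (suc q + suc r) (λ σ →
            cong (λ n → Ψ (n , pos false σ (pos false τ c))) (ℕP.+-assoc (suc p) (suc q) (suc r)))))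

  w-isNTubing : ∀ (p q : ℕ) (u : D p) (v : D q) (ι : Vec (Fin (p + q)) (p + q)) →
                IsShuffle p q ι → IsNTubing (p + q) (w (proj₁ u) (proj₁ v) ι)
  w-isNTubing zero    q       (G , pG) _        _ _  = ⊥-elim (no-0-tubing G pG)
  w-isNTubing (suc p) zero    _        (H , pH) _ _  = ⊥-elim (no-0-tubing H pH)
  w-isNTubing (suc p) (suc q) (G , pG) (H , pH) ι sh =
    isNTubing-cong (λ t → sym (w≡tubing G H m ι H≡tubing sh t)) (tubing-isNTubing (p + suc q) (lookup ι (suc p ↑ʳ m)))
    where
    m : Fin (suc q)
    m = proj₁ (classify-NTubing q H pH)
    H≡tubing : ∀ t → H t ≡ tubing (suc q) m t
    H≡tubing = proj₂ (classify-NTubing q H pH)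

  All-concatMap : ∀ {X Y : Set} {P : Y → Set} {Q : X → Set} (f : X → List Y) xs →
                  All Q xs → (∀ {x} → Q x → All P (f x)) → All P (concatMap f xs)
  All-concatMap f []       []         g = []
  All-concatMap f (x ∷ xs) (qx ∷ qxs) g = AllP.++⁺ (g qx) (All-concatMap f xs qxs g)

  WF-mulB : ∀ r r′ → Proper r → Proper r′ → WF (mulB r r′)
  WF-mulB one     r′      _  pr′ = pr′ ∷ []
  WF-mulB (F p G) one     pG _   = pG ∷ []
  WF-mulB (F p G) (F q H) pG pH  =
    AllP.map⁺ (All.map (λ {ι} sh → w-isNTubing p q (G , pG) (H , pH) ι sh) (AllP.all-filter (isShuffle? p q) (allVecs (p + q) (p + q))))

  WF-· : ∀ x y → WF x → WF y → WF (x · y)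
  WF-· x y wx wy = All-concatMap _ x wx (λ {e} pe → All-concatMap _ y wy (λ {e′} pe′ → AllP.map⁺ (WF-mulB (proj₂ e) (proj₂ e′) pe pe′)))

  mulB-keys : ∀ r r′ → Proper r → Proper r′ → (φ : RawBasis → ℚ) (Ψ : Key → ℚ) → (∀ s → Proper s → φ s ≡ Ψ (keyR s)) →
              eval (mulB r r′) φ ≡ mulKey (keyR r) (keyR r′) Ψ
  mulB-keys one     r′ _ pr′ φ Ψ e = trans (eval-single r′ φ) (e r′ pr′)
  mulB-keys (F p G) one pG _ φ Ψ e with nTubing-positive p G pG
  ... | _ , refl = trans (eval-single (F p G) φ) (e (F p G) pG)
  mulB-keys (F zero G)    (F q H)       pG pH φ Ψ e = ⊥-elim (no-0-tubing G pG)
  mulB-keys (F (suc p) G) (F zero H)    pG pH φ Ψ e = ⊥-elim (no-0-tubing H pH)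
  mulB-keys (F (suc p) G) (F (suc q) H) pG pH φ Ψ e = begin
      eval (mulB (F P G) (F Q H)) φ
    ≡⟨ sumOver-map _ (λ ι → (1ℚ , F (P + Q) (w G H ι))) (shuffles P Q) ⟩
      sumOver (λ ι → 1ℚ ℚ.* φ (F (P + Q) (w G H ι))) (shuffles P Q)
    ≡⟨ sumOver-congAll (All.map (λ {ι} sh → on-shuffles ι sh) (AllP.all-filter (isShuffle? P Q) (allVecs (P + Q) (P + Q)))) ⟩
      sumOver f (shuffles P Q)
    ≡⟨ sumOver-shuffles P Q f ⟩
      sumWords P Q (λ σ → f (shuffleOf P Q σ))
    ≡⟨ sumWords-congShape P Q (λ σ v → cong (λ n → Ψ (P + Q , n)) (shuffleOf-right σ v m)) ⟩
      sumWords P Q (λ σ → Ψ (P + Q , pos false σ (toℕ m)))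
    ≡⟨ sumWords-cong P Q (λ σ → cong (λ n → Ψ (P + Q , pos false σ n)) (sym (missing-classify q H pH))) ⟩
      mulKey (keyR (F P G)) (keyR (F Q H)) Ψ
    ∎
    where
    open ≡-Reasoning
    P Q : ℕ
    P = suc p
    Q = suc q
    m : Fin Q
    m = proj₁ (classify-NTubing q H pH)
    -- the key of w_ι: degree P + Q, missing node ι̂(m)
    f : Vec (Fin (P + Q)) (P + Q) → ℚ
    f ι = Ψ (P + Q , toℕ (lookup ι (P ↑ʳ m)))
    on-shuffles : ∀ ι → IsShuffle P Q ι → 1ℚ ℚ.* φ (F (P + Q) (w G H ι)) ≡ f ι
    on-shuffles ι sh = trans (ℚP.*-identityˡ _) (trans (e _ (w-isNTubing P Q (G , pG) (H , pH) ι sh))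
      (cong (λ n → Ψ (P + Q , n)) (trans (missing-cong (P + Q) (w≡tubing G H m ι (proj₂ (classify-NTubing q H pH)) sh)) (missing-tubing (p + Q) _))))

  Ψ[_] : Basis → Key → ℚ
  Ψ[ b ] k = indK k (keyB b)

  coeff-·-keys : ∀ x y → WF x → WF y → ∀ b → coeff (x · y) b ≡ eval x (λ r → eval y (λ r′ → mulKey (keyR r) (keyR r′) Ψ[ b ]))
  coeff-·-keys x y wx wy b = trans (coeff-eval (x · y) b) (trans (eval-· x y (δ b))
    (eval-congWF x wx (λ r pr → eval-congWF y wy (λ r′ pr′ → mulB-keys r r′ pr pr′ (δ b) Ψ[ b ] (λ s ps → δ-key s ps b)))))

  ·-cong : ∀ x x′ y y′ → WF x → WF x′ → WF y → WF y′ → x ≈ x′ → y ≈ y′ → (x · y) ≈ (x′ · y′)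
  ·-cong x x′ y y′ wx wx′ wy wy′ x≈x′ y≈y′ b = begin
      coeff (x · y) b
    ≡⟨ coeff-·-keys x y wx wy b ⟩
      eval x (λ r → eval y (λ r′ → mulKey (keyR r) (keyR r′) Ψ[ b ]))
    ≡⟨ ≈⇒eval-keys x x′ wx wx′ x≈x′ (λ k → eval y (λ r′ → mulKey k (keyR r′) Ψ[ b ])) ⟩
      eval x′ (λ r → eval y (λ r′ → mulKey (keyR r) (keyR r′) Ψ[ b ]))
    ≡⟨ eval-cong x′ (λ r → ≈⇒eval-keys y y′ wy wy′ y≈y′ (λ k′ → mulKey (keyR r) k′ Ψ[ b ])) ⟩
      eval x′ (λ r → eval y′ (λ r′ → mulKey (keyR r) (keyR r′) Ψ[ b ]))
    ≡⟨ sym (coeff-·-keys x′ y′ wx′ wy′ b) ⟩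
      coeff (x′ · y′) b
    ∎
    where open ≡-Reasoning

  -- bilinearity holds already for the evaluations of formal sums
  ·-distribˡ : ∀ x y z → (x · (y ⊕ z)) ≈ ((x · y) ⊕ (x · z))
  ·-distribˡ x y z = ≈-by-eval (x · (y ⊕ z)) ((x · y) ⊕ (x · z)) λ φ → begin
      eval (x · (y ⊕ z)) φ
    ≡⟨ eval-· x (y ⊕ z) φ ⟩
      eval x (λ r → eval (y ⊕ z) (M φ r))
    ≡⟨ eval-cong x (λ r → eval-⊕ y z (M φ r)) ⟩
      eval x (λ r → eval y (M φ r) ℚ.+ eval z (M φ r))
    ≡⟨ eval-+ x (λ r → eval y (M φ r)) (λ r → eval z (M φ r)) ⟩
      eval x (λ r → eval y (M φ r)) ℚ.+ eval x (λ r → eval z (M φ r))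
    ≡⟨ sym (cong₂ ℚ._+_ (eval-· x y φ) (eval-· x z φ)) ⟩
      eval (x · y) φ ℚ.+ eval (x · z) φ
    ≡⟨ sym (eval-⊕ (x · y) (x · z) φ) ⟩
      eval ((x · y) ⊕ (x · z)) φ
    ∎
    where
    open ≡-Reasoning
    M : (RawBasis → ℚ) → RawBasis → RawBasis → ℚ
    M φ r r′ = eval (mulB r r′) φ

  ·-distribʳ : ∀ x y z → ((x ⊕ y) · z) ≈ ((x · z) ⊕ (y · z))
  ·-distribʳ x y z = ≈-by-eval ((x ⊕ y) · z) ((x · z) ⊕ (y · z)) λ φ → begin
      eval ((x ⊕ y) · z) φ
    ≡⟨ eval-· (x ⊕ y) z φ ⟩
      eval (x ⊕ y) (λ r → eval z (λ r′ → eval (mulB r r′) φ))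
    ≡⟨ eval-⊕ x y _ ⟩
      eval x (λ r → eval z (λ r′ → eval (mulB r r′) φ)) ℚ.+ eval y (λ r → eval z (λ r′ → eval (mulB r r′) φ))
    ≡⟨ sym (cong₂ ℚ._+_ (eval-· x z φ) (eval-· y z φ)) ⟩
      eval (x · z) φ ℚ.+ eval (y · z) φ
    ≡⟨ sym (eval-⊕ (x · z) (y · z) φ) ⟩
      eval ((x · z) ⊕ (y · z)) φ
    ∎
    where open ≡-Reasoning

  ·-⊙ˡ : ∀ c x y → ((c ⊙ x) · y) ≈ (c ⊙ (x · y))
  ·-⊙ˡ c x y = ≈-by-eval ((c ⊙ x) · y) (c ⊙ (x · y)) λ φ → begin
      eval ((c ⊙ x) · y) φ                                   ≡⟨ eval-· (c ⊙ x) y φ ⟩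
      eval (c ⊙ x) (λ r → eval y (λ r′ → eval (mulB r r′) φ)) ≡⟨ eval-⊙ c x _ ⟩
      c ℚ.* eval x (λ r → eval y (λ r′ → eval (mulB r r′) φ)) ≡⟨ cong (c ℚ.*_) (sym (eval-· x y φ)) ⟩
      c ℚ.* eval (x · y) φ                                   ≡⟨ sym (eval-⊙ c (x · y) φ) ⟩
      eval (c ⊙ (x · y)) φ                                   ∎
    where open ≡-Reasoning

  ·-⊙ʳ : ∀ c x y → (x · (c ⊙ y)) ≈ (c ⊙ (x · y))
  ·-⊙ʳ c x y = ≈-by-eval (x · (c ⊙ y)) (c ⊙ (x · y)) λ φ → begin
      eval (x · (c ⊙ y)) φ                                      ≡⟨ eval-· x (c ⊙ y) φ ⟩
      eval x (λ r → eval (c ⊙ y) (λ r′ → eval (mulB r r′) φ))    ≡⟨ eval-cong x (λ r → eval-⊙ c y _) ⟩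
      eval x (λ r → c ℚ.* eval y (λ r′ → eval (mulB r r′) φ))    ≡⟨ eval-* x c _ ⟩
      c ℚ.* eval x (λ r → eval y (λ r′ → eval (mulB r r′) φ))    ≡⟨ cong (c ℚ.*_) (sym (eval-· x y φ)) ⟩
      c ℚ.* eval (x · y) φ                                      ≡⟨ sym (eval-⊙ c (x · y) φ) ⟩
      eval (c ⊙ (x · y)) φ                                      ∎
    where open ≡-Reasoning

  ·-identityˡ : ∀ x → (𝟙 · x) ≈ x
  ·-identityˡ x = ≈-by-eval (𝟙 · x) x λ φ → trans (eval-· 𝟙 x φ)
    (trans (eval-single one (λ r → eval x (λ r′ → eval (mulB r r′) φ))) (eval-cong x (λ r → eval-single r φ)))

  ·-identityʳ : ∀ x → (x · 𝟙) ≈ x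
  ·-identityʳ x = ≈-by-eval (x · 𝟙) x λ φ → trans (eval-· x 𝟙 φ) (eval-cong x (λ r → trans (eval-single one (λ r′ → eval (mulB r r′) φ)) (unitʳ r φ)))
    where
    unitʳ : ∀ r φ → eval (mulB r one) φ ≡ φ r
    unitʳ one     φ = eval-single one φ
    unitʳ (F n G) φ = eval-single (F n G) φ

  ·-assoc : ∀ x y z → WF x → WF y → WF z → ((x · y) · z) ≈ (x · (y · z))
  ·-assoc x y z wx wy wz b = begin
      coeff ((x · y) · z) b
    ≡⟨ coeff-·-keys (x · y) z (WF-· x y wx wy) wz b ⟩
      eval (x · y) (λ s → eval z (λ r₃ → mulKey (keyR s) (keyR r₃) Ψ))
    ≡⟨ eval-· x y _ ⟩
      eval x (λ r₁ → eval y (λ r₂ → eval (mulB r₁ r₂) (λ s → eval z (λ r₃ → mulKey (keyR s) (keyR r₃) Ψ))))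
    ≡⟨ eval-congWF x wx (λ r₁ p₁ → eval-congWF y wy (λ r₂ p₂ → mulB-keys r₁ r₂ p₁ p₂ _ (λ k → eval z (λ r₃ → mulKey k (keyR r₃) Ψ)) (λ _ _ → refl))) ⟩
      eval x (λ r₁ → eval y (λ r₂ → mulKey (keyR r₁) (keyR r₂) (λ k → eval z (λ r₃ → mulKey k (keyR r₃) Ψ))))
    ≡⟨ eval-cong x (λ r₁ → eval-cong y (λ r₂ → mulKey-eval (keyR r₁) (keyR r₂) z (λ k r₃ → mulKey k (keyR r₃) Ψ))) ⟩
      eval x (λ r₁ → eval y (λ r₂ → eval z (λ r₃ → mulKey (keyR r₁) (keyR r₂) (λ k → mulKey k (keyR r₃) Ψ))))
    ≡⟨ eval-cong x (λ r₁ → eval-cong y (λ r₂ → eval-congWF z wz (λ r₃ p₃ → mulKey-assoc (keyR r₁) (keyR r₂) (keyR r₃) Ψ (keyR-valid r₃ p₃)))) ⟩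
      eval x (λ r₁ → eval y (λ r₂ → eval z (λ r₃ → mulKey (keyR r₂) (keyR r₃) (λ k → mulKey (keyR r₁) k Ψ))))
    ≡⟨ sym (eval-cong x (λ r₁ → eval-congWF y wy (λ r₂ p₂ → eval-congWF z wz (λ r₃ p₃ → mulB-keys r₂ r₃ p₂ p₃ _ (λ k → mulKey (keyR r₁) k Ψ) (λ _ _ → refl))))) ⟩
      eval x (λ r₁ → eval y (λ r₂ → eval z (λ r₃ → eval (mulB r₂ r₃) (λ s → mulKey (keyR r₁) (keyR s) Ψ))))
    ≡⟨ sym (eval-cong x (λ r₁ → eval-· y z (λ s → mulKey (keyR r₁) (keyR s) Ψ))) ⟩
      eval x (λ r₁ → eval (y · z) (λ s → mulKey (keyR r₁) (keyR s) Ψ))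
    ≡⟨ sym (coeff-·-keys x (y · z) wx (WF-· y z wy wz) b) ⟩
      coeff (x · (y · z)) b
    ∎
    where
    open ≡-Reasoning
    Ψ : Key → ℚ
    Ψ = Ψ[ b ]

  ·-graded : ∀ (p q : ℕ) x y → WF x → WF y → Homog p x → Homog q y → Homog (p + q) (x · y)
  ·-graded p q x y wx wy hx hy b deg≢ = begin
      coeff (x · y) b
    ≡⟨ coeff-·-keys x y wx wy b ⟩
      eval x (λ r → eval y (λ r′ → mulKey (keyR r) (keyR r′) Ψ))
    ≡⟨ eval-cong x (λ r → homogeneous-eval q y wy hy (λ k′ → mulKey (keyR r) k′ Ψ)) ⟩
      eval x (λ r → eval y (λ r′ → indN (degK (keyR r′)) q ℚ.* mulKey (keyR r) (keyR r′) Ψ))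
    ≡⟨ homogeneous-eval p x wx hx (λ k → eval y (λ r′ → indN (degK (keyR r′)) q ℚ.* mulKey k (keyR r′) Ψ)) ⟩
      eval x (λ r → indN (degK (keyR r)) p ℚ.* eval y (λ r′ → indN (degK (keyR r′)) q ℚ.* mulKey (keyR r) (keyR r′) Ψ))
    ≡⟨ trans (eval-cong x vanishes) (eval-0 x) ⟩
      0ℚ
    ∎
    where
    open ≡-Reasoning
    Ψ : Key → ℚ
    Ψ = Ψ[ b ]
    -- keys of degrees p and q multiply into degree p + q, where Ψ vanishes
    vanishes : ∀ r → indN (degK (keyR r)) p ℚ.* eval y (λ r′ → indN (degK (keyR r′)) q ℚ.* mulKey (keyR r) (keyR r′) Ψ) ≡ 0ℚ
    vanishes r with degK (keyR r) ℕ.≟ p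
    ... | no _  = ℚP.*-zeroˡ (eval y (λ r′ → indN (degK (keyR r′)) q ℚ.* mulKey (keyR r) (keyR r′) Ψ))
    ... | yes dp = trans (ℚP.*-identityˡ _) (trans (eval-cong y vanishes′) (eval-0 y))
      where
      vanishes′ : ∀ r′ → indN (degK (keyR r′)) q ℚ.* mulKey (keyR r) (keyR r′) Ψ ≡ 0ℚ
      vanishes′ r′ with degK (keyR r′) ℕ.≟ q
      ... | no _   = ℚP.*-zeroˡ (mulKey (keyR r) (keyR r′) Ψ)
      ... | yes dq = trans (ℚP.*-identityˡ _) (mulKey-degree (keyR r) (keyR r′) Ψ
            (λ k dk → ind-no (k ≟K keyB b) (λ k≡ → deg≢ (trans (deg-keyB b) (trans (cong degK (sym k≡)) (trans dk (cong₂ _+_ dp dq)))))))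

open import Data.Nat using (_+_)
open Product

theorem7p3 :
  -- w_ι is a (p+q)-tubing of E_{p+q}
  (∀ (p q : ℕ) (u : D p) (v : D q) (ι : Vec (Fin (p + q)) (p + q)) →
     IsShuffle p q ι → IsNTubing (p + q) (w (proj₁ u) (proj₁ v) ι))
  -- ΔSym is closed under the product
  × (∀ x y → WF x → WF y → WF (x · y))
  -- the product is well defined on ΔSym (respects equality)
  × (∀ x x′ y y′ → WF x → WF x′ → WF y → WF y′ → x ≈ x′ → y ≈ y′ → (x · y) ≈ (x′ · y′))
  -- bilinearity
  × (∀ x y z → WF x → WF y → WF z → (x · (y ⊕ z)) ≈ ((x · y) ⊕ (x · z)))
  × (∀ x y z → WF x → WF y → WF z → ((x ⊕ y) · z) ≈ ((x · z) ⊕ (y · z)))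
  × (∀ (c : ℚ) x y → WF x → WF y → ((c ⊙ x) · y) ≈ (c ⊙ (x · y)))
  × (∀ (c : ℚ) x y → WF x → WF y → (x · (c ⊙ y)) ≈ (c ⊙ (x · y)))
  -- associativity
  × (∀ x y z → WF x → WF y → WF z → ((x · y) · z) ≈ (x · (y · z)))
  -- 1 is a two-sided unit
  × (∀ x → WF x → (𝟙 · x) ≈ x)
  × (∀ x → WF x → (x · 𝟙) ≈ x)
  -- gradedness
  × (∀ (p q : ℕ) x y → WF x → WF y → Homog p x → Homog q y → Homog (p + q) (x · y))
theorem7p3 =
  w-isNTubing ,
  WF-· ,
  ·-cong ,
  (λ x y z _ _ _ → ·-distribˡ x y z) ,
  (λ x y z _ _ _ → ·-distribʳ x y z) ,
  (λ c x y _ _ → ·-⊙ˡ c x y) ,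
  (λ c x y _ _ → ·-⊙ʳ c x y) ,
  ·-assoc ,
  (λ x _ → ·-identityˡ x) ,
  (λ x _ → ·-identityʳ x) ,
  ·-graded
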